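{- Let $k \geq 3$ and let $\Gamma$ be a graph on $n$ vertices with vertex degrees $d_1,\dots,d_n$ which has the same Laplacian spectrum as some $k$-rose graph. If $\Gamma$ is not a rose graph, then $$\sum_{i=1}^n (d_i-2)^3< (2k-2)^3-6k.$$
   Context: Graphs are finite, simple and undirected. For $k\ge2$, a $k$-rose graph is a connected graph with one vertex of degree $2k$ and all other vertices of degree $2$ (equivalently, $k$ cycles meeting in a single common vertex); a rose graph is a $k'$-rose graph for some $k'\ge2$. The Laplacian spectrum of a graph is the multiset of eigenvalues of $L=D-A$, where $A$ is the adjacency matrix and $D$ the diagonal degree matrix. -}

module Defs where

open import Data.Nat as ℕ using (ℕ; zero; suc)
open import Data.Integer as ℤ using (ℤ; +_; -_)
open import Data.Fin using (Fin; zero; suc; punchIn; toℕ)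
open import Data.Bool using (Bool; true; false; if_then_else_)
open import Data.List using (List; []; _∷_; map)
open import Data.Product using (Σ; _×_; ∃)
open import Relation.Binary.PropositionalEquality using (_≡_; _≢_)
open import Relation.Nullary using (does)
open import Data.Fin.Properties using () renaming (_≟_ to _≟F_)

record Graph (n : ℕ) : Set where
  field
    adj    : Fin n → Fin n → Bool
    sym    : ∀ i j → adj i j ≡ adj j i
    irrefl : ∀ i → adj i i ≡ false
open Graph public

∑ : ∀ {A : Set} (_⊕_ : A → A → A) (e : A) (n : ℕ) → (Fin n → A) → A
∑ _⊕_ e zero    f = e
∑ _⊕_ e (suc n) f = f zero ⊕ ∑ _⊕_ e n (λ i → f (suc i))

degree : ∀ {n} → Graph n → Fin n → ℕ
degree {n} G i = ∑ ℕ._+_ 0 n (λ j → if adj G i j then 1 else 0)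

data Reach {n : ℕ} (G : Graph n) (i : Fin n) : Fin n → Set where
  here : Reach G i i
  step : ∀ {j l} → Reach G i j → adj G j l ≡ true → Reach G i l

Connected : ∀ {n} → Graph n → Set
Connected G = ∀ i j → Reach G i j

IsKRose : ℕ → ∀ {n} → Graph n → Set
IsKRose k G = (2 ℕ.≤ k) × Connected G ×
  Σ _ (λ v → degree G v ≡ 2 ℕ.* k × (∀ u → u ≢ v → degree G u ≡ 2))

IsRose : ∀ {n} → Graph n → Set
IsRose G = ∃ λ k → IsKRose k G

laplacian : ∀ {n} → Graph n → Fin n → Fin n → ℤ
laplacian G i j =
  (if does (i ≟F j) then + degree G i else + 0)
  ℤ.- (if adj G i j then + 1 else + 0)

-- Polynomials over ℤ as coefficient lists (constant term first)

Poly : Set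
Poly = List ℤ

_+P_ : Poly → Poly → Poly
[] +P q = q
(a ∷ p) +P [] = a ∷ p
(a ∷ p) +P (b ∷ q) = (a ℤ.+ b) ∷ (p +P q)

scaleP : ℤ → Poly → Poly
scaleP a = map (a ℤ.*_)

_*P_ : Poly → Poly → Poly
[] *P q = []
(a ∷ p) *P q = scaleP a q +P (+ 0 ∷ (p *P q))

coeff : Poly → ℕ → ℤ
coeff []      _       = + 0
coeff (a ∷ p) zero    = a
coeff (a ∷ p) (suc i) = coeff p i

altSign : ℕ → ℤ
altSign zero = + 1
altSign (suc m) = - altSign m

det : ∀ n → (Fin n → Fin n → Poly) → Poly
det zero    M = + 1 ∷ []
det (suc n) M = ∑ _+P_ [] (suc n) (λ j →
  scaleP (altSign (toℕ j)) (M zero j *P det n (λ r c → M (suc r) (punchIn j c))))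

laplacianCharPoly : ∀ {n} → Graph n → Poly
laplacianCharPoly {n} G = det n (λ i j →
  if does (i ≟F j) then (- laplacian G i j) ∷ + 1 ∷ [] else (- laplacian G i j) ∷ [])

-- Same Laplacian spectrum (multiset of eigenvalues = roots of the
-- characteristic polynomial with multiplicity): equal characteristic
-- polynomials.  Graphs with the same spectrum have the same number of
-- vertices, so both graphs live on Fin n.
SameLaplacianSpectrum : ∀ {n} → Graph n → Graph n → Set
SameLaplacianSpectrum G H = ∀ i → coeff (laplacianCharPoly G) i ≡ coeff (laplacianCharPoly H) i

cubeExcess : ∀ {n} → Graph n → ℤ
cubeExcess {n} G = ∑ ℤ._+_ (+ 0) n (λ i → let d = + degree G i ℤ.- + 2 in d ℤ.* d ℤ.* d)

{-# OPTIONS --safe #-}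
module Submission where

-- The coefficients of x^(n-1) and x^(n-2) in det(x I - L) determine Σ dᵢ and Σ dᵢ², so Γ shares with the k-rose
-- the value Σ (dᵢ - 2)² = S², S = 2k - 2. For integers xᵢ with Σ xᵢ² = S², either some xᵢ = S and all others vanish,
-- or every xᵢ ≤ S - 1 and Σ xᵢ³ ≤ (S - 1) S² < S³ - 6k (for k = 3 the value xᵢ = 3 needs a finer count).
-- In the first case Γ has the degree sequence of a k-rose, so it is a rose once it is connected. It is: for a
-- disconnected graph t² divides det(t I - L) for every t, while for a connected one det(t I - L) = t D(t), where D(t)
-- replaces one column of t I - L by ones and D(0) ≠ 0, since a kernel vector of that matrix would give a nonzero
-- harmonic function vanishing at a vertex.

open import Defs hiding (sym)
open import Data.Nat as ℕ using (ℕ; zero; suc; z≤n; s≤s)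
import Data.Nat.Properties as ℕP
open import Data.Integer as ℤ using (ℤ; +_; -_; _+_; _*_; _-_; _^_; _≤_; _<_; +≤+; +<+; -[1+_])
import Data.Integer.Properties as ℤP
open import Data.Integer.Tactic.RingSolver using (solve-∀)
open import Data.Fin using (Fin; zero; suc; toℕ; punchIn; punchOut; inject₁; fromℕ<)
open import Data.Fin.Properties
  using (_≟_; all?; ¬∀⟶∃¬; toℕ<n; toℕ-fromℕ<; toℕ-inject₁; toℕ-injective; suc-injective;
         punchIn-injective; punchInᵢ≢i; punchIn-punchOut)
import Data.Fin.Permutation.Components as PC
open import Data.Fin.Permutation using (transpose)
open import Data.Bool using (true; false; if_then_else_)
open import Data.List using ([]; _∷_)
open import Data.Empty using (⊥; ⊥-elim)
open import Data.Sum using (_⊎_; inj₁; inj₂; [_,_]′)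
open import Data.Product using (Σ; _×_; _,_; ∃; proj₁; proj₂)
open import Function using (_∘_; id)
open import Relation.Nullary using (¬_; Dec; yes; no; does; ¬¬-excluded-middle)
open import Relation.Nullary.Reflects using (ofʸ; ofⁿ)
open import Relation.Nullary.Decidable using (dec-true; dec-false)
open import Relation.Binary.PropositionalEquality
open import Relation.Binary.Definitions using (tri<; tri≈; tri>)
import Algebra.Properties.CommutativeMonoid.Sum as CommutativeMonoidSum
open import Algebra.Bundles using (AbelianGroup)
open import Algebra.Properties.Group (AbelianGroup.group ℤP.+-0-abelianGroup) using (∙-cancelˡ; ∙-cancelʳ)

-- Finite sums of integers

∑ℤ : ∀ n → (Fin n → ℤ) → ℤ
∑ℤ = ∑ _+_ (+ 0)

module ∑Lib = CommutativeMonoidSum ℤP.+-0-commutativeMonoid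

∑ℤ≡sum : ∀ n (f : Fin n → ℤ) → ∑ℤ n f ≡ ∑Lib.sum f
∑ℤ≡sum zero    f = refl
∑ℤ≡sum (suc n) f = cong (_+_ (f zero)) (∑ℤ≡sum n (f ∘ suc))

∑ℤ-cong : ∀ n {f g : Fin n → ℤ} → (∀ i → f i ≡ g i) → ∑ℤ n f ≡ ∑ℤ n g
∑ℤ-cong zero    e = refl
∑ℤ-cong (suc n) e = cong₂ _+_ (e zero) (∑ℤ-cong n (e ∘ suc))

∑ℤ-distrib-+ : ∀ n (f g : Fin n → ℤ) → ∑ℤ n (λ i → f i + g i) ≡ ∑ℤ n f + ∑ℤ n g
∑ℤ-distrib-+ n f g = begin
  ∑ℤ n (λ i → f i + g i)          ≡⟨ ∑ℤ≡sum n _ ⟩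
  ∑Lib.sum (λ i → f i + g i)      ≡⟨ ∑Lib.∑-distrib-+ f g ⟩
  ∑Lib.sum f + ∑Lib.sum g         ≡⟨ sym (cong₂ _+_ (∑ℤ≡sum n f) (∑ℤ≡sum n g)) ⟩
  ∑ℤ n f + ∑ℤ n g                 ∎
  where open ≡-Reasoning

∑ℤ-comm : ∀ m n (f : Fin m → Fin n → ℤ) →
          ∑ℤ m (λ i → ∑ℤ n (f i)) ≡ ∑ℤ n (λ j → ∑ℤ m (λ i → f i j))
∑ℤ-comm m n f = begin
  ∑ℤ m (λ i → ∑ℤ n (f i))                   ≡⟨ ∑ℤ-cong m (λ i → ∑ℤ≡sum n (f i)) ⟩
  ∑ℤ m (λ i → ∑Lib.sum (f i))               ≡⟨ ∑ℤ≡sum m _ ⟩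
  ∑Lib.sum (λ i → ∑Lib.sum (f i))           ≡⟨ ∑Lib.∑-comm f ⟩
  ∑Lib.sum (λ j → ∑Lib.sum (λ i → f i j))   ≡⟨ sym (∑ℤ≡sum n _) ⟩
  ∑ℤ n (λ j → ∑Lib.sum (λ i → f i j))       ≡⟨ sym (∑ℤ-cong n (λ j → ∑ℤ≡sum m _)) ⟩
  ∑ℤ n (λ j → ∑ℤ m (λ i → f i j))           ∎
  where open ≡-Reasoning

∑ℤ-transpose : ∀ n (i j : Fin n) (f : Fin n → ℤ) → ∑ℤ n (f ∘ PC.transpose i j) ≡ ∑ℤ n f
∑ℤ-transpose n i j f = begin
  ∑ℤ n (f ∘ PC.transpose i j)      ≡⟨ ∑ℤ≡sum n _ ⟩
  ∑Lib.sum (f ∘ PC.transpose i j)  ≡⟨ sym (∑Lib.∑-permute f (transpose i j)) ⟩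
  ∑Lib.sum f                       ≡⟨ sym (∑ℤ≡sum n f) ⟩
  ∑ℤ n f                           ∎
  where open ≡-Reasoning

*-distribˡ-∑ℤ : ∀ n c (f : Fin n → ℤ) → ∑ℤ n (λ i → c * f i) ≡ c * ∑ℤ n f
*-distribˡ-∑ℤ zero    c f = sym (ℤP.*-zeroʳ c)
*-distribˡ-∑ℤ (suc n) c f = begin
  c * f zero + ∑ℤ n (λ i → c * f (suc i))  ≡⟨ cong (_+_ (c * f zero)) (*-distribˡ-∑ℤ n c (f ∘ suc)) ⟩
  c * f zero + c * ∑ℤ n (f ∘ suc)          ≡⟨ sym (ℤP.*-distribˡ-+ c (f zero) _) ⟩
  c * ∑ℤ (suc n) f                         ∎
  where open ≡-Reasoning

*-distribʳ-∑ℤ : ∀ n c (f : Fin n → ℤ) → ∑ℤ n (λ i → f i * c) ≡ ∑ℤ n f * c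
*-distribʳ-∑ℤ n c f = begin
  ∑ℤ n (λ i → f i * c)  ≡⟨ ∑ℤ-cong n (λ i → ℤP.*-comm (f i) c) ⟩
  ∑ℤ n (λ i → c * f i)  ≡⟨ *-distribˡ-∑ℤ n c f ⟩
  c * ∑ℤ n f            ≡⟨ ℤP.*-comm c _ ⟩
  ∑ℤ n f * c            ∎
  where open ≡-Reasoning

∑ℤ-const : ∀ n a → ∑ℤ n (λ _ → a) ≡ + n * a
∑ℤ-const zero    a = sym (ℤP.*-zeroˡ a)
∑ℤ-const (suc n) a = begin
  a + ∑ℤ n (λ _ → a)  ≡⟨ cong (_+_ a) (∑ℤ-const n a) ⟩
  a + + n * a         ≡⟨ cong (_+ + n * a) (sym (ℤP.*-identityˡ a)) ⟩
  + 1 * a + + n * a   ≡⟨ sym (ℤP.*-distribʳ-+ a (+ 1) (+ n)) ⟩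
  + suc n * a         ∎
  where open ≡-Reasoning

∑ℤ-zero : ∀ n (f : Fin n → ℤ) → (∀ i → f i ≡ + 0) → ∑ℤ n f ≡ + 0
∑ℤ-zero n f f≡0 = trans (∑ℤ-cong n f≡0) (trans (∑ℤ-const n (+ 0)) (ℤP.*-zeroʳ (+ n)))

∑ℤ-neg : ∀ n (f : Fin n → ℤ) → ∑ℤ n (λ i → - f i) ≡ - ∑ℤ n f
∑ℤ-neg n f = begin
  ∑ℤ n (λ i → - f i)        ≡⟨ ∑ℤ-cong n (λ i → sym (ℤP.-1*i≡-i (f i))) ⟩
  ∑ℤ n (λ i → - + 1 * f i)  ≡⟨ *-distribˡ-∑ℤ n (- + 1) f ⟩
  - + 1 * ∑ℤ n f            ≡⟨ ℤP.-1*i≡-i (∑ℤ n f) ⟩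
  - ∑ℤ n f                  ∎
  where open ≡-Reasoning

∑ℤ-distrib-- : ∀ n (f g : Fin n → ℤ) → ∑ℤ n (λ i → f i - g i) ≡ ∑ℤ n f - ∑ℤ n g
∑ℤ-distrib-- n f g = trans (∑ℤ-distrib-+ n f (λ i → - g i)) (cong (_+_ (∑ℤ n f)) (∑ℤ-neg n g))

∑ℤ-single : ∀ n (f : Fin n → ℤ) i → (∀ j → j ≢ i → f j ≡ + 0) → ∑ℤ n f ≡ f i
∑ℤ-single (suc n) f zero    others =
  trans (cong (_+_ (f zero)) (∑ℤ-zero n _ (λ j → others (suc j) (λ ())))) (ℤP.+-identityʳ _)
∑ℤ-single (suc n) f (suc i) others =
  trans (cong₂ _+_ (others zero (λ ())) (∑ℤ-single n (f ∘ suc) i (λ j j≢i → others (suc j) (j≢i ∘ suc-injective))))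
        (ℤP.+-identityˡ _)

∑ℤ-indicator : ∀ n (i : Fin n) c → ∑ℤ n (λ j → if does (j ≟ i) then c else + 0) ≡ c
∑ℤ-indicator n i c = trans (∑ℤ-single n _ i others) (cong (if_then c else + 0) (dec-true (i ≟ i) refl))
  where
  others : ∀ j → j ≢ i → (if does (j ≟ i) then c else + 0) ≡ + 0
  others j j≢i rewrite dec-false (j ≟ i) j≢i = refl

without : ∀ {n} → Fin n → (Fin n → ℤ) → Fin n → ℤ
without i f j = if does (j ≟ i) then + 0 else f j

without-≢ : ∀ {n} {i j : Fin n} (f : Fin n → ℤ) → j ≢ i → without i f j ≡ f j
without-≢ {i = i} {j} f j≢i rewrite dec-false (j ≟ i) j≢i = refl

∑ℤ-without : ∀ n (i : Fin n) (f : Fin n → ℤ) → ∑ℤ n f ≡ f i + ∑ℤ n (without i f)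
∑ℤ-without n i f = begin
  ∑ℤ n f                                                             ≡⟨ ∑ℤ-cong n split ⟩
  ∑ℤ n (λ j → (if does (j ≟ i) then f i else + 0) + without i f j)  ≡⟨ ∑ℤ-distrib-+ n _ _ ⟩
  ∑ℤ n (λ j → if does (j ≟ i) then f i else + 0) + ∑ℤ n (without i f)
    ≡⟨ cong (_+ ∑ℤ n (without i f)) (∑ℤ-indicator n i (f i)) ⟩
  f i + ∑ℤ n (without i f)                                           ∎
  where
  open ≡-Reasoning
  split : ∀ j → f j ≡ (if does (j ≟ i) then f i else + 0) + without i f j
  split j with j ≟ i
  ... | yes refl = sym (ℤP.+-identityʳ (f j))
  ... | no _     = sym (ℤP.+-identityˡ (f j))

∑ℤ-pair : ∀ n (f : Fin n → ℤ) a b → a ≢ b → (∀ j → j ≢ a → j ≢ b → f j ≡ + 0) → ∑ℤ n f ≡ f a + f b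
∑ℤ-pair n f a b a≢b others =
  trans (∑ℤ-without n a f) (cong (_+_ (f a)) (trans (∑ℤ-single n (without a f) b rest) (without-≢ f (a≢b ∘ sym))))
  where
  rest : ∀ j → j ≢ b → without a f j ≡ + 0
  rest j j≢b with j ≟ a
  ... | yes _   = refl
  ... | no j≢a = others j j≢a j≢b

∑ℤ-mono-≤ : ∀ n {f g : Fin n → ℤ} → (∀ i → f i ≤ g i) → ∑ℤ n f ≤ ∑ℤ n g
∑ℤ-mono-≤ zero    f≤g = ℤP.≤-refl
∑ℤ-mono-≤ (suc n) f≤g = ℤP.+-mono-≤ (f≤g zero) (∑ℤ-mono-≤ n (f≤g ∘ suc))

∑ℤ-nonneg : ∀ n {f : Fin n → ℤ} → (∀ i → + 0 ≤ f i) → + 0 ≤ ∑ℤ n f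
∑ℤ-nonneg n {f} f≥0 = subst (_≤ ∑ℤ n f) (∑ℤ-zero n _ (λ _ → refl)) (∑ℤ-mono-≤ n f≥0)

without-nonneg : ∀ {n} (i : Fin n) {f : Fin n → ℤ} → (∀ j → + 0 ≤ f j) → ∀ j → + 0 ≤ without i f j
without-nonneg i f≥0 j with j ≟ i
... | yes _ = ℤP.≤-refl
... | no _  = f≥0 j

term≤∑ℤ : ∀ n {f : Fin n → ℤ} → (∀ i → + 0 ≤ f i) → ∀ i → f i ≤ ∑ℤ n f
term≤∑ℤ n {f} f≥0 i = begin
  f i                        ≡⟨ ℤP.+-identityʳ (f i) ⟨
  f i + + 0                  ≤⟨ ℤP.+-monoʳ-≤ (f i) (∑ℤ-nonneg n (without-nonneg i f≥0)) ⟩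
  f i + ∑ℤ n (without i f)   ≡⟨ ∑ℤ-without n i f ⟨
  ∑ℤ n f                     ∎
  where open ℤP.≤-Reasoning

∑ℤ≡0⇒terms≡0 : ∀ n {f : Fin n → ℤ} → (∀ i → + 0 ≤ f i) → ∑ℤ n f ≡ + 0 → ∀ i → f i ≡ + 0
∑ℤ≡0⇒terms≡0 n f≥0 ∑≡0 i = ℤP.≤-antisym (subst (_ ≤_) ∑≡0 (term≤∑ℤ n f≥0 i)) (f≥0 i)

∑ℕ-+ : ∀ n (f : Fin n → ℕ) → + (∑ ℕ._+_ 0 n f) ≡ ∑ℤ n (λ i → + f i)
∑ℕ-+ zero    f = refl
∑ℕ-+ (suc n) f = trans (ℤP.pos-+ (f zero) _) (cong (_+_ (+ f zero)) (∑ℕ-+ n (f ∘ suc)))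

-- The degree-excess inequality

hubExcess : ℕ → ℤ
hubExcess k = + (2 ℕ.* k) - + 2

cubeBound : ℕ → ℤ
cubeBound k = hubExcess k * hubExcess k * hubExcess k - + 6 * + k

square-nonneg : ∀ x → + 0 ≤ x * x
square-nonneg (+ m)    = subst (+ 0 ≤_) (ℤP.pos-* m m) (+≤+ z≤n)
square-nonneg -[1+ m ] = +≤+ z≤n

cube≤ : ∀ {x c} → x ≤ c → x * x * x ≤ c * (x * x)
cube≤ {x} {c} x≤c = subst (_≤ c * (x * x)) (ℤP.*-comm x (x * x))
  (ℤP.*-monoʳ-≤-nonNeg (x * x) {{ℤ.nonNegative (square-nonneg x)}} x≤c)

∑cube≤ : ∀ n {x : Fin n → ℤ} {c} → (∀ i → x i ≤ c) →
         ∑ℤ n (λ i → x i * x i * x i) ≤ c * ∑ℤ n (λ i → x i * x i)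
∑cube≤ n {x} {c} x≤c = ℤP.≤-trans (∑ℤ-mono-≤ n (λ i → cube≤ (x≤c i))) (ℤP.≤-reflexive (*-distribˡ-∑ℤ n c _))

argmax : ∀ n (x : Fin (suc n) → ℤ) → Σ (Fin (suc n)) λ m → ∀ i → x i ≤ x m
argmax zero    x = zero , λ { zero → ℤP.≤-refl }
argmax (suc n) x with argmax n (x ∘ suc)
... | m , max with ℤP.≤-total (x zero) (x (suc m))
...   | inj₁ x₀≤ = suc m , λ { zero → x₀≤ ; (suc i) → max i }
...   | inj₂ ≤x₀ = zero , λ { zero → ℤP.≤-refl ; (suc i) → ℤP.≤-trans (max i) ≤x₀ }

square-sum-concentrated : ∀ n (x : Fin n → ℤ) i {s} → + 0 ≤ s → s ≤ x i →
  ∑ℤ n (λ j → x j * x j) ≡ s * s → x i ≡ s × (∀ j → j ≢ i → x j ≡ + 0)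
square-sum-concentrated n x i {s} 0≤s s≤xi ∑≡s² = xi≡s , others
  where
  x² : Fin n → ℤ
  x² j = x j * x j
  xi≤s : x i ≤ s
  xi≤s = ℤP.≮⇒≥ λ s<xi → ℤP.<-irrefl refl (begin-strict
    s * s      ≤⟨ ℤP.*-monoˡ-≤-nonNeg s {{ℤ.nonNegative 0≤s}} (ℤP.<⇒≤ s<xi) ⟩
    s * x i    <⟨ ℤP.*-monoʳ-<-pos (x i) {{ℤ.positive (ℤP.≤-<-trans 0≤s s<xi)}} s<xi ⟩
    x² i       ≤⟨ term≤∑ℤ n (square-nonneg ∘ x) i ⟩
    ∑ℤ n x²    ≡⟨ ∑≡s² ⟩
    s * s      ∎)
    where open ℤP.≤-Reasoning
  xi≡s : x i ≡ s
  xi≡s = ℤP.≤-antisym xi≤s s≤xi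
  rest≡0 : ∑ℤ n (without i x²) ≡ + 0
  rest≡0 = ∙-cancelˡ (x² i) _ _ (begin
    x² i + ∑ℤ n (without i x²)  ≡⟨ ∑ℤ-without n i x² ⟨
    ∑ℤ n x²                     ≡⟨ ∑≡s² ⟩
    s * s                       ≡⟨ cong (λ y → y * y) xi≡s ⟨
    x² i                        ≡⟨ ℤP.+-identityʳ (x² i) ⟨
    x² i + + 0                  ∎)
    where open ≡-Reasoning
  others : ∀ j → j ≢ i → x j ≡ + 0
  others j j≢i with ℤP.i*j≡0⇒i≡0∨j≡0 (x j)
         (trans (sym (without-≢ x² j≢i)) (∑ℤ≡0⇒terms≡0 n (without-nonneg i (square-nonneg ∘ x)) rest≡0 j))
  ... | inj₁ xj≡0 = xj≡0
  ... | inj₂ xj≡0 = xj≡0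

cubeBound-gap : ∀ j → let S = hubExcess (4 ℕ.+ j) in (S - + 1) * (S * S) < cubeBound (4 ℕ.+ j)
cubeBound-gap j = begin-strict
  (S - + 1) * (S * S)                         ≡⟨ ℤP.+-identityʳ _ ⟨
  (S - + 1) * (S * S) + + 0                   <⟨ ℤP.+-monoʳ-< ((S - + 1) * (S * S)) (+<+ (s≤s z≤n)) ⟩
  (S - + 1) * (S * S) + + gap                 ≡⟨ cong₂ (λ s g → (s - + 1) * (s * s) + g) S≡ gap≡ ⟩
  (h - + 1) * (h * h) + (+ 12 + + 18 * t + + 4 * (t * t))  ≡⟨ identity t ⟨
  h * h * h - + 6 * (+ 4 + t)                 ≡⟨ cong₂ (λ s k → s * s * s - + 6 * k) S≡ (ℤP.pos-+ 4 j) ⟨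
  cubeBound (4 ℕ.+ j)                         ∎
  where
  open ℤP.≤-Reasoning
  S t h : ℤ
  S = hubExcess (4 ℕ.+ j)
  t = + j
  h = + 2 * (+ 4 + t) - + 2
  gap : ℕ
  gap = 12 ℕ.+ 18 ℕ.* j ℕ.+ 4 ℕ.* (j ℕ.* j)
  S≡ : S ≡ h
  S≡ = cong (_- + 2) (trans (ℤP.pos-* 2 (4 ℕ.+ j)) (cong (+ 2 *_) (ℤP.pos-+ 4 j)))
  gap≡ : + gap ≡ + 12 + + 18 * t + + 4 * (t * t)
  gap≡ = trans (ℤP.pos-+ (12 ℕ.+ 18 ℕ.* j) _)
    (cong₂ _+_ (trans (ℤP.pos-+ 12 _) (cong (_+_ (+ 12)) (ℤP.pos-* 18 j)))
               (trans (ℤP.pos-* 4 (j ℕ.* j)) (cong (+ 4 *_) (ℤP.pos-* j j))))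
  identity : ∀ t → let h = + 2 * (+ 4 + t) - + 2 in
    h * h * h - + 6 * (+ 4 + t) ≡ (h - + 1) * (h * h) + (+ 12 + + 18 * t + + 4 * (t * t))
  identity = solve-∀

-- For k = 3 the crude bound (S - 1) S² is not enough and the largest value 3 needs a closer look.
cube-sum-bound-k3 : ∀ m (x : Fin (suc m) → ℤ) → (∀ i → x i < + 4) →
  ∑ℤ (suc m) (λ i → x i * x i) ≡ + 16 → ∑ℤ (suc m) (λ i → x i * x i * x i) < + 46
cube-sum-bound-k3 m x x<4 ∑x²≡16 with argmax m x
... | M , max with x M ℤP.≟ + 3
...   | no xM≢3 = ℤP.≤-<-trans
  (ℤP.≤-trans (∑cube≤ n (λ i → ℤP.≤-trans (max i) xM≤2)) (ℤP.≤-reflexive (cong (+ 2 *_) ∑x²≡16)))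
  (+<+ (ℕP.<ᵇ⇒< 32 46 _))
  where
  n : ℕ
  n = suc m
  xM≤2 : x M ≤ + 2
  xM≤2 = ℤP.i<j⇒i≤pred[j] (ℤP.≤∧≢⇒< (ℤP.i<j⇒i≤pred[j] (x<4 M)) xM≢3)
...   | yes xM≡3 = ℤP.≤-<-trans total≤41 (+<+ (ℕP.<ᵇ⇒< 41 46 _))
  where
  n : ℕ
  n = suc m
  x² x³ : Fin n → ℤ
  x² i = x i * x i
  x³ i = x i * x i * x i
  rest≡7 : ∑ℤ n (without M x²) ≡ + 7
  rest≡7 = ∙-cancelˡ (x² M) _ _ (begin
    x² M + ∑ℤ n (without M x²)  ≡⟨ ∑ℤ-without n M x² ⟨
    ∑ℤ n x²                     ≡⟨ ∑x²≡16 ⟩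
    + 9 + + 7                   ≡⟨ cong (λ y → y * y + + 7) xM≡3 ⟨
    x² M + + 7                  ∎)
    where open ≡-Reasoning
  others≤2 : ∀ j → j ≢ M → x j ≤ + 2
  others≤2 j j≢M = ℤP.i<j⇒i≤pred[j] (ℤP.≤∧≢⇒< (subst (x j ≤_) xM≡3 (max j)) xj≢3)
    where
    xj≢3 : x j ≢ + 3
    xj≢3 xj≡3 = ℤP.<⇒≱ (+<+ (ℕP.<ᵇ⇒< 7 9 _)) (begin
      + 9                         ≡⟨ cong (λ y → y * y) xj≡3 ⟨
      x² j                        ≡⟨ without-≢ x² j≢M ⟨
      without M x² j              ≤⟨ term≤∑ℤ n (without-nonneg M (square-nonneg ∘ x)) j ⟩
      ∑ℤ n (without M x²)         ≡⟨ rest≡7 ⟩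
      + 7                         ∎)
      where open ℤP.≤-Reasoning
  rest³≤ : ∀ j → without M x³ j ≤ + 2 * without M x² j
  rest³≤ j with j ≟ M
  ... | yes _   = ℤP.≤-refl
  ... | no j≢M = cube≤ (others≤2 j j≢M)
  total≤41 : ∑ℤ n x³ ≤ + 41
  total≤41 = begin
    ∑ℤ n x³                           ≡⟨ ∑ℤ-without n M x³ ⟩
    x³ M + ∑ℤ n (without M x³)        ≤⟨ ℤP.+-monoʳ-≤ (x³ M) (∑ℤ-mono-≤ n rest³≤) ⟩
    x³ M + ∑ℤ n (λ j → + 2 * without M x² j)  ≡⟨ cong₂ (λ y r → y * y * y + r) xM≡3 (*-distribˡ-∑ℤ n (+ 2) (without M x²)) ⟩
    + 27 + + 2 * ∑ℤ n (without M x²)  ≡⟨ cong (λ r → + 27 + + 2 * r) rest≡7 ⟩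
    + 41                              ∎
    where open ℤP.≤-Reasoning

cube-sum-below : ∀ m (x : Fin (suc m) → ℤ) k → 3 ℕ.≤ k → (∀ i → x i < hubExcess k) →
  ∑ℤ (suc m) (λ i → x i * x i) ≡ hubExcess k * hubExcess k → ∑ℤ (suc m) (λ i → x i * x i * x i) < cubeBound k
cube-sum-below m x 3                            (s≤s (s≤s (s≤s _))) = cube-sum-bound-k3 m x
cube-sum-below m x k@(suc (suc (suc (suc j)))) (s≤s (s≤s (s≤s _))) x<S ∑x²≡S² = ℤP.≤-<-trans
  (ℤP.≤-trans (∑cube≤ (suc m) (λ i → ℤP.i<j⇒i≤pred[j] (x<S i)))
              (ℤP.≤-reflexive (cong (ℤ.pred (hubExcess k) *_) ∑x²≡S²)))
  (cubeBound-gap j)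

excess-inequality : ∀ m (x : Fin (suc m) → ℤ) k → 3 ℕ.≤ k →
  ∑ℤ (suc m) (λ i → x i * x i) ≡ hubExcess k * hubExcess k →
  ∑ℤ (suc m) (λ i → x i * x i * x i) < cubeBound k ⊎
  Σ (Fin (suc m)) (λ v → x v ≡ hubExcess k × (∀ j → j ≢ v → x j ≡ + 0))
excess-inequality m x k 3≤k@(s≤s (s≤s (s≤s _))) ∑x²≡S² with argmax m x
... | M , max with ℤP.<-cmp (x M) (hubExcess k)
...   | tri< xM<S _ _ = inj₁ (cube-sum-below m x k 3≤k (λ i → ℤP.≤-<-trans (max i) xM<S) ∑x²≡S²)
...   | tri≈ _ xM≡S _ = inj₂ (M , square-sum-concentrated (suc m) x M (+≤+ z≤n) (ℤP.≤-reflexive (sym xM≡S)) ∑x²≡S²)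
...   | tri> _ _ S<xM = inj₂ (M , square-sum-concentrated (suc m) x M (+≤+ z≤n) (ℤP.<⇒≤ S<xM) ∑x²≡S²)

-- Integer polynomials

∑P : ∀ n → (Fin n → Poly) → Poly
∑P = ∑ _+P_ []

DegreeAtMost : Poly → ℕ → Set
DegreeAtMost p d = ∀ i → d ℕ.< i → coeff p i ≡ + 0

coeff-+P : ∀ p q i → coeff (p +P q) i ≡ coeff p i + coeff q i
coeff-+P []      q       i       = sym (ℤP.+-identityˡ _)
coeff-+P (a ∷ p) []      i       = sym (ℤP.+-identityʳ _)
coeff-+P (a ∷ p) (b ∷ q) zero    = refl
coeff-+P (a ∷ p) (b ∷ q) (suc i) = coeff-+P p q i

coeff-scaleP : ∀ a p i → coeff (scaleP a p) i ≡ a * coeff p i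
coeff-scaleP a []      i       = sym (ℤP.*-zeroʳ a)
coeff-scaleP a (b ∷ p) zero    = refl
coeff-scaleP a (b ∷ p) (suc i) = coeff-scaleP a p i

coeff-∑P : ∀ n (f : Fin n → Poly) i → coeff (∑P n f) i ≡ ∑ℤ n (λ j → coeff (f j) i)
coeff-∑P zero    f i = refl
coeff-∑P (suc n) f i = trans (coeff-+P (f zero) _ i) (cong (_+_ (coeff (f zero) i)) (coeff-∑P n (f ∘ suc) i))

coeff-∷*P : ∀ a p q i → coeff ((a ∷ p) *P q) i ≡ a * coeff q i + coeff (+ 0 ∷ (p *P q)) i
coeff-∷*P a p q i = trans (coeff-+P (scaleP a q) _ i) (cong (_+ _) (coeff-scaleP a q i))

coeff-[a]*P : ∀ a q i → coeff ((a ∷ []) *P q) i ≡ a * coeff q i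
coeff-[a]*P a q zero    = trans (coeff-∷*P a [] q 0) (ℤP.+-identityʳ _)
coeff-[a]*P a q (suc i) = trans (coeff-∷*P a [] q (suc i)) (ℤP.+-identityʳ _)

coeff-linear*P : ∀ a q i → coeff ((a ∷ + 1 ∷ []) *P q) (suc i) ≡ a * coeff q (suc i) + coeff q i
coeff-linear*P a q i =
  trans (coeff-∷*P a (+ 1 ∷ []) q (suc i)) (cong (_+_ (a * coeff q (suc i))) (trans (coeff-[a]*P (+ 1) q i) (ℤP.*-identityˡ _)))

coeff₀-linear*P : ∀ a q → coeff ((a ∷ + 1 ∷ []) *P q) 0 ≡ a * coeff q 0
coeff₀-linear*P a q = trans (coeff-∷*P a (+ 1 ∷ []) q 0) (ℤP.+-identityʳ _)

*P-zero : ∀ p q → (∀ i → coeff p i ≡ + 0) → ∀ i → coeff (p *P q) i ≡ + 0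
*P-zero []      q p≡0 i = refl
*P-zero (a ∷ p) q p≡0 i =
  trans (coeff-∷*P a p q i) (cong₂ _+_ (trans (cong (_* coeff q i) (p≡0 0)) (ℤP.*-zeroˡ (coeff q i))) (shifted i))
  where
  shifted : ∀ i → coeff (+ 0 ∷ (p *P q)) i ≡ + 0
  shifted zero    = refl
  shifted (suc i) = *P-zero p q (p≡0 ∘ suc) i

*P-degree : ∀ p q d e → DegreeAtMost p d → DegreeAtMost q e →
            DegreeAtMost (p *P q) (d ℕ.+ e) × coeff (p *P q) (d ℕ.+ e) ≡ coeff p d * coeff q e
*P-degree []      q d       e p≤d q≤e = (λ _ _ → refl) , refl
*P-degree (a ∷ p) q zero    e p≤d q≤e = bounded , leading
  where
  tail≡0 : ∀ i → coeff (+ 0 ∷ (p *P q)) i ≡ + 0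
  tail≡0 zero    = refl
  tail≡0 (suc i) = *P-zero p q (λ i → p≤d (suc i) (s≤s z≤n)) i
  bounded : DegreeAtMost ((a ∷ p) *P q) e
  bounded i e<i = trans (coeff-∷*P a p q i)
    (trans (cong₂ _+_ (trans (cong (a *_) (q≤e i e<i)) (ℤP.*-zeroʳ a)) (tail≡0 i)) refl)
  leading : coeff ((a ∷ p) *P q) e ≡ a * coeff q e
  leading = trans (coeff-∷*P a p q e) (trans (cong (_+_ (a * coeff q e)) (tail≡0 e)) (ℤP.+-identityʳ _))
*P-degree (a ∷ p) q (suc d) e p≤d q≤e = bounded , leading
  where
  ih : DegreeAtMost (p *P q) (d ℕ.+ e) × coeff (p *P q) (d ℕ.+ e) ≡ coeff p d * coeff q e
  ih = *P-degree p q d e (λ i d<i → p≤d (suc i) (s≤s d<i)) q≤e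
  q-high : ∀ i → d ℕ.+ e ℕ.≤ i → coeff q (suc i) ≡ + 0
  q-high i d+e≤i = q≤e (suc i) (s≤s (ℕP.≤-trans (ℕP.m≤n+m e d) d+e≤i))
  bounded : DegreeAtMost ((a ∷ p) *P q) (suc d ℕ.+ e)
  bounded zero    ()
  bounded (suc i) (s≤s d+e<i) = trans (coeff-∷*P a p q (suc i))
    (trans (cong₂ _+_ (trans (cong (a *_) (q-high i (ℕP.<⇒≤ d+e<i))) (ℤP.*-zeroʳ a)) (proj₁ ih i d+e<i)) refl)
  leading : coeff ((a ∷ p) *P q) (suc d ℕ.+ e) ≡ coeff p d * coeff q e
  leading = trans (coeff-∷*P a p q (suc (d ℕ.+ e)))
    (trans (cong₂ _+_ (trans (cong (a *_) (q-high (d ℕ.+ e) ℕP.≤-refl)) (ℤP.*-zeroʳ a)) (proj₂ ih)) (ℤP.+-identityˡ _))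

∑P-degree : ∀ n (f : Fin n → Poly) d → (∀ j → DegreeAtMost (f j) d) → DegreeAtMost (∑P n f) d
∑P-degree n f d f≤d i d<i = trans (coeff-∑P n f i) (∑ℤ-zero n _ (λ j → f≤d j i d<i))

scaleP-degree : ∀ a p d → DegreeAtMost p d → DegreeAtMost (scaleP a p) d
scaleP-degree a p d p≤d i d<i = trans (coeff-scaleP a p i) (trans (cong (a *_) (p≤d i d<i)) (ℤP.*-zeroʳ a))

eval : Poly → ℤ → ℤ
eval []      t = + 0
eval (a ∷ p) t = a + t * eval p t

eval-+P : ∀ p q t → eval (p +P q) t ≡ eval p t + eval q t
eval-+P []      q       t = sym (ℤP.+-identityˡ _)
eval-+P (a ∷ p) []      t = sym (ℤP.+-identityʳ _)
eval-+P (a ∷ p) (b ∷ q) t = trans (cong (λ y → a + b + t * y) (eval-+P p q t)) (regroup a b t (eval p t) (eval q t))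
  where
  regroup : ∀ a b t x y → a + b + t * (x + y) ≡ a + t * x + (b + t * y)
  regroup = solve-∀

eval-scaleP : ∀ a p t → eval (scaleP a p) t ≡ a * eval p t
eval-scaleP a []      t = sym (ℤP.*-zeroʳ a)
eval-scaleP a (b ∷ p) t = trans (cong (λ y → a * b + t * y) (eval-scaleP a p t)) (regroup a b t (eval p t))
  where
  regroup : ∀ a b t x → a * b + t * (a * x) ≡ a * (b + t * x)
  regroup = solve-∀

eval-*P : ∀ p q t → eval (p *P q) t ≡ eval p t * eval q t
eval-*P []      q t = refl
eval-*P (a ∷ p) q t = trans (eval-+P (scaleP a q) (+ 0 ∷ (p *P q)) t)
  (trans (cong₂ (λ x y → x + (+ 0 + t * y)) (eval-scaleP a q t) (eval-*P p q t)) (regroup a t (eval p t) (eval q t)))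
  where
  regroup : ∀ a t x y → a * y + (+ 0 + t * (x * y)) ≡ (a + t * x) * y
  regroup = solve-∀

eval-∑P : ∀ n (f : Fin n → Poly) t → eval (∑P n f) t ≡ ∑ℤ n (λ j → eval (f j) t)
eval-∑P zero    f t = refl
eval-∑P (suc n) f t = trans (eval-+P (f zero) _ t) (cong (_+_ (eval (f zero) t)) (eval-∑P n (f ∘ suc) t))

eval-low-order : ∀ p t → ∃ λ r → eval p t ≡ coeff p 0 + t * coeff p 1 + t * t * r
eval-low-order []          t = + 0 , expand t
  where
  expand : ∀ t → + 0 ≡ + 0 + t * + 0 + t * t * + 0
  expand = solve-∀
eval-low-order (a ∷ [])    t = + 0 , expand a t
  where
  expand : ∀ a t → a + t * + 0 ≡ a + t * + 0 + t * t * + 0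
  expand = solve-∀
eval-low-order (a ∷ b ∷ p) t = eval p t , expand a b t (eval p t)
  where
  expand : ∀ a b t x → a + t * (b + t * x) ≡ a + t * b + t * t * x
  expand = solve-∀

-- Determinants by expansion along the first row

Matrix : ℕ → Set
Matrix n = Fin n → Fin n → ℤ

minor : ∀ {n} → Matrix (suc n) → Fin (suc n) → Matrix n
minor M j r c = M (suc r) (punchIn j c)

detℤ : ∀ n → Matrix n → ℤ
detℤ zero    M = + 1
detℤ (suc n) M = ∑ℤ (suc n) (λ j → altSign (toℕ j) * (M zero j * detℤ n (minor M j)))

expansionTerm : ∀ {n} → Matrix (suc n) → Fin (suc n) → ℤ
expansionTerm {n} M j = altSign (toℕ j) * (M zero j * detℤ n (minor M j))

detℤ-cong : ∀ n {M N : Matrix n} → (∀ r c → M r c ≡ N r c) → detℤ n M ≡ detℤ n N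
detℤ-cong zero    M≡N = refl
detℤ-cong (suc n) M≡N = ∑ℤ-cong (suc n) (λ j →
  cong₂ (λ x y → altSign (toℕ j) * (x * y)) (M≡N zero j) (detℤ-cong n (λ r c → M≡N (suc r) (punchIn j c))))

eval-det : ∀ n (N : Fin n → Fin n → Poly) t → eval (det n N) t ≡ detℤ n (λ r c → eval (N r c) t)
eval-det zero    N t = cong (_+_ (+ 1)) (ℤP.*-zeroʳ t)
eval-det (suc n) N t = trans (eval-∑P (suc n) (λ j → scaleP (altSign (toℕ j)) (N zero j *P det n (minorP j))) t)
  (∑ℤ-cong (suc n) (λ j → begin
  eval (scaleP (altSign (toℕ j)) (N zero j *P det n (minorP j))) t
    ≡⟨ eval-scaleP (altSign (toℕ j)) (N zero j *P det n (minorP j)) t ⟩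
  altSign (toℕ j) * eval (N zero j *P det n (minorP j)) t
    ≡⟨ cong (altSign (toℕ j) *_) (eval-*P (N zero j) (det n (minorP j)) t) ⟩
  altSign (toℕ j) * (eval (N zero j) t * eval (det n (minorP j)) t)
    ≡⟨ cong (λ y → altSign (toℕ j) * (eval (N zero j) t * y)) (eval-det n (minorP j) t) ⟩
  altSign (toℕ j) * (eval (N zero j) t * detℤ n (λ r c → eval (minorP j r c) t))  ∎))
  where
  open ≡-Reasoning
  minorP : Fin (suc n) → Fin n → Fin n → Poly
  minorP j r c = N (suc r) (punchIn j c)

∑ℕ-punchIn : ∀ n (d : Fin (suc n) → ℕ) j → d j ℕ.+ ∑ ℕ._+_ 0 n (d ∘ punchIn j) ≡ ∑ ℕ._+_ 0 (suc n) d
∑ℕ-punchIn n       d zero    = refl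
∑ℕ-punchIn (suc n) d (suc j) =
  trans (swap (d (suc j)) (d zero) _) (cong (d zero ℕ.+_) (∑ℕ-punchIn n (d ∘ suc) j))
  where
  swap : ∀ a b c → a ℕ.+ (b ℕ.+ c) ≡ b ℕ.+ (a ℕ.+ c)
  swap a b c = trans (sym (ℕP.+-assoc a b c)) (trans (cong (ℕ._+ c) (ℕP.+-comm a b)) (ℕP.+-assoc b a c))

det-leading : ∀ n (N : Fin n → Fin n → Poly) (d : Fin n → ℕ) → (∀ r c → DegreeAtMost (N r c) (d c)) →
  DegreeAtMost (det n N) (∑ ℕ._+_ 0 n d) × coeff (det n N) (∑ ℕ._+_ 0 n d) ≡ detℤ n (λ r c → coeff (N r c) (d c))
det-leading zero    N d N≤d = (λ { (suc i) _ → refl }) , refl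
det-leading (suc n) N d N≤d = ∑P-degree (suc n) term D term≤D , trans (coeff-∑P (suc n) term D) (∑ℤ-cong (suc n) leading)
  where
  D : ℕ
  D = ∑ ℕ._+_ 0 (suc n) d
  minorP : Fin (suc n) → Fin n → Fin n → Poly
  minorP j r c = N (suc r) (punchIn j c)
  Dj : Fin (suc n) → ℕ
  Dj j = ∑ ℕ._+_ 0 n (d ∘ punchIn j)
  term : Fin (suc n) → Poly
  term j = scaleP (altSign (toℕ j)) (N zero j *P det n (minorP j))
  ih : ∀ j → DegreeAtMost (det n (minorP j)) (Dj j) ×
             coeff (det n (minorP j)) (Dj j) ≡ detℤ n (λ r c → coeff (minorP j r c) (d (punchIn j c)))
  ih j = det-leading n (minorP j) (d ∘ punchIn j) (λ r c → N≤d (suc r) (punchIn j c))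
  product : ∀ j → DegreeAtMost (N zero j *P det n (minorP j)) (d j ℕ.+ Dj j) ×
                  coeff (N zero j *P det n (minorP j)) (d j ℕ.+ Dj j) ≡ coeff (N zero j) (d j) * coeff (det n (minorP j)) (Dj j)
  product j = *P-degree (N zero j) (det n (minorP j)) (d j) (Dj j) (N≤d zero j) (proj₁ (ih j))
  term≤D : ∀ j → DegreeAtMost (term j) D
  term≤D j = scaleP-degree (altSign (toℕ j)) (N zero j *P det n (minorP j)) D
    (subst (DegreeAtMost (N zero j *P det n (minorP j))) (∑ℕ-punchIn n d j) (proj₁ (product j)))
  leading : ∀ j → coeff (term j) D ≡
    altSign (toℕ j) * (coeff (N zero j) (d j) * detℤ n (λ r c → coeff (minorP j r c) (d (punchIn j c))))
  leading j = trans (coeff-scaleP (altSign (toℕ j)) (N zero j *P det n (minorP j)) D) (cong (altSign (toℕ j) *_) (begin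
    coeff (N zero j *P det n (minorP j)) D                    ≡⟨ cong (coeff (N zero j *P det n (minorP j))) (∑ℕ-punchIn n d j) ⟨
    coeff (N zero j *P det n (minorP j)) (d j ℕ.+ Dj j)       ≡⟨ proj₂ (product j) ⟩
    coeff (N zero j) (d j) * coeff (det n (minorP j)) (Dj j)  ≡⟨ cong (coeff (N zero j) (d j) *_) (proj₂ (ih j)) ⟩
    coeff (N zero j) (d j) * detℤ n (λ r c → coeff (minorP j r c) (d (punchIn j c)))  ∎))
    where open ≡-Reasoning

AgreeOff : ∀ {n} → Fin n → Matrix n → Matrix n → Set
AgreeOff c A C = ∀ r k → k ≢ c → A r k ≡ C r k

minor-agree-at : ∀ {n} {c : Fin (suc n)} {A C : Matrix (suc n)} → AgreeOff c A C → ∀ r k → minor A c r k ≡ minor C c r k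
minor-agree-at {c = c} A≈C r k = A≈C (suc r) (punchIn c k) (punchInᵢ≢i c k)

minor-agree-off : ∀ {n} {c j : Fin (suc n)} {A C : Matrix (suc n)} (j≢c : j ≢ c) →
                  AgreeOff c A C → AgreeOff (punchOut j≢c) (minor A j) (minor C j)
minor-agree-off {j = j} j≢c A≈C r k k≢c′ =
  A≈C (suc r) (punchIn j k) (λ e → k≢c′ (punchIn-injective j k _ (trans e (sym (punchIn-punchOut j≢c)))))

minor-column : ∀ {n} {c j : Fin (suc n)} (A : Matrix (suc n)) (j≢c : j ≢ c) r → minor A j r (punchOut j≢c) ≡ A (suc r) c
minor-column A j≢c r = cong (A (suc r)) (punchIn-punchOut j≢c)

detℤ-additive : ∀ n (A B C : Matrix n) c → AgreeOff c A C → AgreeOff c B C →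
                (∀ r → C r c ≡ A r c + B r c) → detℤ n C ≡ detℤ n A + detℤ n B
detℤ-additive (suc n) A B C c A≈C B≈C Cc≡ =
  trans (∑ℤ-cong (suc n) term) (∑ℤ-distrib-+ (suc n) (expansionTerm A) (expansionTerm B))
  where
  term : ∀ j → expansionTerm C j ≡ expansionTerm A j + expansionTerm B j
  term j with j ≟ c
  ... | yes refl = begin
    s * (C zero j * detℤ n (minor C j))
      ≡⟨ cong₂ (λ x y → s * (x * y)) (Cc≡ zero) (detℤ-cong n (λ r k → sym (minor-agree-at A≈C r k))) ⟩
    s * ((A zero j + B zero j) * detℤ n (minor A j))   ≡⟨ distrib s (A zero j) (B zero j) _ ⟩
    s * (A zero j * detℤ n (minor A j)) + s * (B zero j * detℤ n (minor A j))
      ≡⟨ cong (λ y → s * (A zero j * detℤ n (minor A j)) + s * (B zero j * y))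
              (detℤ-cong n (λ r k → trans (minor-agree-at A≈C r k) (sym (minor-agree-at B≈C r k)))) ⟩
    s * (A zero j * detℤ n (minor A j)) + s * (B zero j * detℤ n (minor B j))  ∎
    where
    open ≡-Reasoning
    s : ℤ
    s = altSign (toℕ j)
    distrib : ∀ s a b d → s * ((a + b) * d) ≡ s * (a * d) + s * (b * d)
    distrib = solve-∀
  ... | no j≢c = begin
    s * (C zero j * detℤ n (minor C j))                  ≡⟨ cong (λ y → s * (C zero j * y)) ih ⟩
    s * (C zero j * (detℤ n (minor A j) + detℤ n (minor B j)))  ≡⟨ distrib s (C zero j) _ _ ⟩
    s * (C zero j * detℤ n (minor A j)) + s * (C zero j * detℤ n (minor B j))
      ≡⟨ cong₂ (λ x y → s * (x * detℤ n (minor A j)) + s * (y * detℤ n (minor B j))) (A≈C zero j j≢c) (B≈C zero j j≢c) ⟨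
    s * (A zero j * detℤ n (minor A j)) + s * (B zero j * detℤ n (minor B j))  ∎
    where
    open ≡-Reasoning
    s : ℤ
    s = altSign (toℕ j)
    distrib : ∀ s a x y → s * (a * (x + y)) ≡ s * (a * x) + s * (a * y)
    distrib = solve-∀
    ih : detℤ n (minor C j) ≡ detℤ n (minor A j) + detℤ n (minor B j)
    ih = detℤ-additive n (minor A j) (minor B j) (minor C j) (punchOut j≢c)
      (minor-agree-off j≢c A≈C) (minor-agree-off j≢c B≈C)
      (λ r → trans (minor-column C j≢c r) (trans (Cc≡ (suc r))
               (sym (cong₂ _+_ (minor-column A j≢c r) (minor-column B j≢c r)))))

detℤ-homogeneous : ∀ n (A C : Matrix n) c a → AgreeOff c A C → (∀ r → C r c ≡ a * A r c) → detℤ n C ≡ a * detℤ n A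
detℤ-homogeneous (suc n) A C c a A≈C Cc≡ = trans (∑ℤ-cong (suc n) term) (*-distribˡ-∑ℤ (suc n) a (expansionTerm A))
  where
  term : ∀ j → expansionTerm C j ≡ a * expansionTerm A j
  term j with j ≟ c
  ... | yes refl = trans (cong₂ (λ x y → s * (x * y)) (Cc≡ zero) (detℤ-cong n (λ r k → sym (minor-agree-at A≈C r k))))
                         (regroup s a (A zero j) (detℤ n (minor A j)))
    where
    s : ℤ
    s = altSign (toℕ j)
    regroup : ∀ s a b d → s * ((a * b) * d) ≡ a * (s * (b * d))
    regroup = solve-∀
  ... | no j≢c = trans (cong (λ y → s * (C zero j * y)) ih)
                   (trans (regroup s (C zero j) a (detℤ n (minor A j)))
                          (cong (λ y → a * (s * (y * detℤ n (minor A j)))) (sym (A≈C zero j j≢c))))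
    where
    s : ℤ
    s = altSign (toℕ j)
    regroup : ∀ s b a x → s * (b * (a * x)) ≡ a * (s * (b * x))
    regroup = solve-∀
    ih : detℤ n (minor C j) ≡ a * detℤ n (minor A j)
    ih = detℤ-homogeneous n (minor A j) (minor C j) (punchOut j≢c) a (minor-agree-off j≢c A≈C)
      (λ r → trans (minor-column C j≢c r) (trans (Cc≡ (suc r)) (cong (a *_) (sym (minor-column A j≢c r)))))

detℤ-zero-column : ∀ n (A : Matrix n) c → (∀ r → A r c ≡ + 0) → detℤ n A ≡ + 0
detℤ-zero-column n A c Ac≡0 = trans
  (detℤ-homogeneous n A A c (+ 0) (λ _ _ _ → refl) (λ r → trans (Ac≡0 r) (sym (ℤP.*-zeroˡ (A r c)))))
  (ℤP.*-zeroˡ (detℤ n A))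

inject₁≢suc : ∀ {n} (c : Fin n) → inject₁ c ≢ suc c
inject₁≢suc zero    ()
inject₁≢suc (suc c) = inject₁≢suc c ∘ suc-injective

punchIn-around : ∀ {n} (j : Fin (suc (suc n))) (c : Fin (suc n)) → j ≢ inject₁ c → j ≢ suc c →
  Σ (Fin n) λ c′ → punchIn j (inject₁ c′) ≡ inject₁ c × punchIn j (suc c′) ≡ suc c
punchIn-around zero                 zero    j≢c   _      = ⊥-elim (j≢c refl)
punchIn-around zero                 (suc c) _     _      = c , refl , refl
punchIn-around (suc zero)           zero    _     j≢c+1  = ⊥-elim (j≢c+1 refl)
punchIn-around {suc n} (suc (suc j)) zero   _     _      = zero , refl , refl
punchIn-around {suc n} (suc j)      (suc c) j≢c   j≢c+1 with punchIn-around j c (j≢c ∘ cong suc) (j≢c+1 ∘ cong suc)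
... | c′ , left , right = suc c′ , cong suc left , cong suc right

punchIn-adjacent : ∀ {n} (c k : Fin n) →
  punchIn (inject₁ c) k ≡ punchIn (suc c) k ⊎ (punchIn (inject₁ c) k ≡ suc c × punchIn (suc c) k ≡ inject₁ c)
punchIn-adjacent zero    zero    = inj₂ (refl , refl)
punchIn-adjacent zero    (suc k) = inj₁ refl
punchIn-adjacent (suc c) zero    = inj₁ refl
punchIn-adjacent (suc c) (suc k) with punchIn-adjacent c k
... | inj₁ same            = inj₁ (cong suc same)
... | inj₂ (left , right) = inj₂ (cong suc left , cong suc right)

-- The two surviving expansion terms cancel: their minors coincide and their signs are opposite.
detℤ-adjacent-equal : ∀ n (M : Matrix (suc n)) (c : Fin n) → (∀ r → M r (inject₁ c) ≡ M r (suc c)) →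
                      detℤ (suc n) M ≡ + 0
detℤ-adjacent-equal (suc n) M c cols≡ =
  trans (∑ℤ-pair (suc (suc n)) (expansionTerm M) (inject₁ c) (suc c) (inject₁≢suc c) vanishing) cancel
  where
  vanishing : ∀ j → j ≢ inject₁ c → j ≢ suc c → expansionTerm M j ≡ + 0
  vanishing j j≢c j≢c+1 with punchIn-around j c j≢c j≢c+1
  ... | c′ , left , right = begin
    altSign (toℕ j) * (M zero j * detℤ (suc n) (minor M j))  ≡⟨ cong (λ y → altSign (toℕ j) * (M zero j * y)) minor≡0 ⟩
    altSign (toℕ j) * (M zero j * + 0)                        ≡⟨ cong (altSign (toℕ j) *_) (ℤP.*-zeroʳ (M zero j)) ⟩
    altSign (toℕ j) * + 0                                     ≡⟨ ℤP.*-zeroʳ (altSign (toℕ j)) ⟩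
    + 0                                                       ∎
    where
    open ≡-Reasoning
    minor≡0 : detℤ (suc n) (minor M j) ≡ + 0
    minor≡0 = detℤ-adjacent-equal n (minor M j) c′
      (λ r → trans (cong (M (suc r)) left) (trans (cols≡ (suc r)) (cong (M (suc r)) (sym right))))
  minors≡ : ∀ r k → minor M (inject₁ c) r k ≡ minor M (suc c) r k
  minors≡ r k with punchIn-adjacent c k
  ... | inj₁ same            = cong (M (suc r)) same
  ... | inj₂ (left , right) = trans (cong (M (suc r)) left) (trans (sym (cols≡ (suc r))) (cong (M (suc r)) (sym right)))
  cancel : expansionTerm M (inject₁ c) + expansionTerm M (suc c) ≡ + 0
  cancel = begin
    altSign (toℕ (inject₁ c)) * (M zero (inject₁ c) * detℤ (suc n) (minor M (inject₁ c))) + expansionTerm M (suc c)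
      ≡⟨ cong₂ (λ s x → s * (x * detℤ (suc n) (minor M (inject₁ c))) + expansionTerm M (suc c))
               (cong altSign (toℕ-inject₁ c)) (cols≡ zero) ⟩
    s * (a * detℤ (suc n) (minor M (inject₁ c))) + - s * (a * d)
      ≡⟨ cong (λ y → s * (a * y) + - s * (a * d)) (detℤ-cong (suc n) minors≡) ⟩
    s * (a * d) + - s * (a * d)  ≡⟨ opposite s (a * d) ⟩
    + 0                          ∎
    where
    open ≡-Reasoning
    s a d : ℤ
    s = altSign (toℕ c)
    a = M zero (suc c)
    d = detℤ (suc n) (minor M (suc c))
    opposite : ∀ s x → s * x + - s * x ≡ + 0
    opposite = solve-∀

setCol : ∀ {n} → Matrix n → Fin n → (Fin n → ℤ) → Matrix n
setCol M s v r k = if does (k ≟ s) then v r else M r k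

setCol-same : ∀ {n} (M : Matrix n) s v r → setCol M s v r s ≡ v r
setCol-same M s v r rewrite dec-true (s ≟ s) refl = refl

setCol-other : ∀ {n} (M : Matrix n) {s} v r {k} → k ≢ s → setCol M s v r k ≡ M r k
setCol-other M {s} v r {k} k≢s rewrite dec-false (k ≟ s) k≢s = refl

setCol-agree : ∀ {n} (M : Matrix n) s v w → AgreeOff s (setCol M s v) (setCol M s w)
setCol-agree M s v w r k k≢s = trans (setCol-other M v r k≢s) (sym (setCol-other M w r k≢s))

setCol-cong : ∀ {n} (M : Matrix n) s {v w : Fin n → ℤ} → (∀ r → v r ≡ w r) →
              ∀ r c → setCol M s v r c ≡ setCol M s w r c
setCol-cong M s v≡w r c with c ≟ s
... | yes _ = v≡w r
... | no _  = refl

setCol-own-column : ∀ {n} (M : Matrix n) s r c → setCol M s (λ r → M r s) r c ≡ M r c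
setCol-own-column M s r c with c ≟ s
... | yes refl = refl
... | no _     = refl

setCol-comm : ∀ {n} (M : Matrix n) {i j} x y → i ≢ j → ∀ r c →
              setCol (setCol M j y) i x r c ≡ setCol (setCol M i x) j y r c
setCol-comm M {i} {j} x y i≢j r c with c ≟ i | c ≟ j
... | yes refl | yes refl = ⊥-elim (i≢j refl)
... | yes refl | no _     = refl
... | no _     | yes refl = refl
... | no _     | no _     = refl

detℤ-setCol-+ : ∀ n (M : Matrix n) s v w →
  detℤ n (setCol M s (λ r → v r + w r)) ≡ detℤ n (setCol M s v) + detℤ n (setCol M s w)
detℤ-setCol-+ n M s v w = detℤ-additive n _ _ _ s (setCol-agree M s v v+w) (setCol-agree M s w v+w)
  (λ r → trans (setCol-same M s v+w r) (sym (cong₂ _+_ (setCol-same M s v r) (setCol-same M s w r))))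
  where
  v+w : Fin n → ℤ
  v+w r = v r + w r

detℤ-setCol-* : ∀ n (M : Matrix n) s a v → detℤ n (setCol M s (λ r → a * v r)) ≡ a * detℤ n (setCol M s v)
detℤ-setCol-* n M s a v = detℤ-homogeneous n (setCol M s v) _ s a (setCol-agree M s v av)
  (λ r → trans (setCol-same M s av r) (cong (a *_) (sym (setCol-same M s v r))))
  where
  av : Fin n → ℤ
  av r = a * v r

-- An alternating form is antisymmetric: expand 0 = S(u + w, u + w) for the bilinear S(x, y)
-- that puts x in column i and y in column j.
detℤ-antisymmetric : ∀ n (M : Matrix n) i j → i ≢ j →
  (∀ (N : Matrix n) → (∀ r → N r i ≡ N r j) → detℤ n N ≡ + 0) →
  detℤ n (λ r c → M r (PC.transpose i j c)) ≡ - detℤ n M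
detℤ-antisymmetric n M i j i≢j alternating = begin
  detℤ n (λ r c → M r (PC.transpose i j c))  ≡⟨ detℤ-cong n swapped ⟨
  S w u                                      ≡⟨ cancel (S w u) (S u w) S-anti ⟩
  - S u w                                    ≡⟨ cong -_ (detℤ-cong n original) ⟩
  - detℤ n M                                 ∎
  where
  open ≡-Reasoning
  S : (Fin n → ℤ) → (Fin n → ℤ) → ℤ
  S x y = detℤ n (setCol (setCol M j y) i x)
  S-diag : ∀ x → S x x ≡ + 0
  S-diag x = alternating _ (λ r → trans (setCol-same (setCol M j x) i x r)
    (sym (trans (setCol-other (setCol M j x) x r (i≢j ∘ sym)) (setCol-same M j x r))))
  S-+ˡ : ∀ x x′ y → S (λ r → x r + x′ r) y ≡ S x y + S x′ y
  S-+ˡ x x′ y = detℤ-setCol-+ n (setCol M j y) i x x′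
  S-+ʳ : ∀ x y y′ → S x (λ r → y r + y′ r) ≡ S x y + S x y′
  S-+ʳ x y y′ = trans (detℤ-cong n (setCol-comm M x (λ r → y r + y′ r) i≢j))
    (trans (detℤ-setCol-+ n (setCol M i x) j y y′)
      (sym (cong₂ _+_ (detℤ-cong n (setCol-comm M x y i≢j)) (detℤ-cong n (setCol-comm M x y′ i≢j)))))
  u w : Fin n → ℤ
  u r = M r i
  w r = M r j
  u+w : Fin n → ℤ
  u+w r = u r + w r
  S-anti : S u w + S w u ≡ + 0
  S-anti = begin
    S u w + S w u                    ≡⟨ cong₂ _+_ (ℤP.+-identityˡ (S u w)) (ℤP.+-identityʳ (S w u)) ⟨
    (+ 0 + S u w) + (S w u + + 0)    ≡⟨ cong₂ _+_ (trans (S-+ʳ u u w) (cong (_+ S u w) (S-diag u)))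
                                                 (trans (S-+ʳ w u w) (cong (_+_ (S w u)) (S-diag w))) ⟨
    S u u+w + S w u+w                ≡⟨ S-+ˡ u w u+w ⟨
    S u+w u+w                        ≡⟨ S-diag u+w ⟩
    + 0                              ∎
  cancel : ∀ a b → b + a ≡ + 0 → a ≡ - b
  cancel a b b+a≡0 = trans (sym (regroup a b)) (trans (cong (_+ - b) b+a≡0) (ℤP.+-identityˡ (- b)))
    where
    regroup : ∀ a b → b + a + - b ≡ a
    regroup = solve-∀
  original : ∀ r c → setCol (setCol M j w) i u r c ≡ M r c
  original r c with c ≟ i
  ... | yes refl = refl
  ... | no _ with c ≟ j
  ... | yes refl = refl
  ... | no _     = refl
  swapped : ∀ r c → setCol (setCol M j u) i w r c ≡ M r (PC.transpose i j c)
  swapped r c with c ≟ i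
  ... | yes _ = refl
  ... | no _ with c ≟ j
  ... | yes _ = refl
  ... | no _  = refl

transpose-left : ∀ {n} (i j : Fin n) → PC.transpose i j i ≡ j
transpose-left i j rewrite dec-true (i ≟ i) refl = refl

transpose-other : ∀ {n} {i j k : Fin n} → k ≢ i → k ≢ j → PC.transpose i j k ≡ k
transpose-other {i = i} {j} {k} k≢i k≢j rewrite dec-false (k ≟ i) k≢i | dec-false (k ≟ j) k≢j = refl

-- Induction on the distance d + 1 between the equal columns: swapping column j with its left neighbour brings them closer.
detℤ-equal-columns-apart : ∀ d n (M : Matrix n) (i j : Fin n) → suc (toℕ i ℕ.+ d) ≡ toℕ j →
                           (∀ r → M r i ≡ M r j) → detℤ n M ≡ + 0
detℤ-equal-columns-apart d       (suc n) M i zero    ()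
detℤ-equal-columns-apart zero    (suc n) M i (suc c) i+1≡j cols≡ =
  detℤ-adjacent-equal n M c (λ r → trans (cong (M r) c≡i) (cols≡ r))
  where
  c≡i : inject₁ c ≡ i
  c≡i = toℕ-injective (trans (toℕ-inject₁ c) (sym (trans (sym (ℕP.+-identityʳ (toℕ i))) (ℕP.suc-injective i+1≡j))))
detℤ-equal-columns-apart (suc d) (suc n) M i (suc c) i+d+2≡j cols≡ = begin
  detℤ (suc n) M          ≡⟨ ℤP.neg-involutive _ ⟨
  - - detℤ (suc n) M      ≡⟨ cong -_ swap ⟨
  - detℤ (suc n) M′       ≡⟨ cong -_ M′≡0 ⟩
  + 0                     ∎
  where
  open ≡-Reasoning
  c₁ : Fin (suc n)
  c₁ = inject₁ c
  i+d+1≡c₁ : suc (toℕ i ℕ.+ d) ≡ toℕ c₁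
  i+d+1≡c₁ = trans (sym (ℕP.+-suc (toℕ i) d)) (trans (ℕP.suc-injective i+d+2≡j) (sym (toℕ-inject₁ c)))
  i≢c₁ : i ≢ c₁
  i≢c₁ e = ℕP.m≢1+m+n (toℕ i) (trans (cong toℕ e) (sym i+d+1≡c₁))
  i≢c+1 : i ≢ suc c
  i≢c+1 e = ℕP.m≢1+m+n (toℕ i) (trans (cong toℕ e) (sym i+d+2≡j))
  M′ : Matrix (suc n)
  M′ r k = M r (PC.transpose c₁ (suc c) k)
  M′≡0 : detℤ (suc n) M′ ≡ + 0
  M′≡0 = detℤ-equal-columns-apart d (suc n) M′ i c₁ i+d+1≡c₁ (λ r →
    trans (cong (M r) (transpose-other i≢c₁ i≢c+1)) (trans (cols≡ r) (cong (M r) (sym (transpose-left c₁ (suc c))))))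
  swap : detℤ (suc n) M′ ≡ - detℤ (suc n) M
  swap = detℤ-antisymmetric (suc n) M c₁ (suc c) (inject₁≢suc c) (λ N → detℤ-adjacent-equal n N c)

detℤ-equal-columns : ∀ n (M : Matrix n) {i j} → i ≢ j → (∀ r → M r i ≡ M r j) → detℤ n M ≡ + 0
detℤ-equal-columns n M {i} {j} i≢j cols≡ with ℕP.<-cmp (toℕ i) (toℕ j)
... | tri< i<j _ _ = let d , i+1+d≡j = ℕP.m≤n⇒∃[o]m+o≡n i<j in detℤ-equal-columns-apart d n M i j i+1+d≡j cols≡
... | tri≈ _ i≡j _ = ⊥-elim (i≢j (toℕ-injective i≡j))
... | tri> _ _ j<i = let d , j+1+d≡i = ℕP.m≤n⇒∃[o]m+o≡n j<i in detℤ-equal-columns-apart d n M j i j+1+d≡i (sym ∘ cols≡)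

detℤ-swap-columns : ∀ n (M : Matrix n) {i j} → i ≢ j → detℤ n (λ r c → M r (PC.transpose i j c)) ≡ - detℤ n M
detℤ-swap-columns n M {i} {j} i≢j = detℤ-antisymmetric n M i j i≢j (λ N → detℤ-equal-columns n N i≢j)

detℤ-copy-column : ∀ n (M : Matrix n) {s c} → s ≢ c → detℤ n (setCol M s (λ r → M r c)) ≡ + 0
detℤ-copy-column n M {s} {c} s≢c = detℤ-equal-columns n _ s≢c (λ r →
  trans (setCol-same M s col r) (sym (setCol-other M col r (s≢c ∘ sym))))
  where
  col : Fin n → ℤ
  col r = M r c

detℤ-setCol-∑ : ∀ n m (M : Matrix n) s (F : Fin m → Fin n → ℤ) →
  detℤ n (setCol M s (λ r → ∑ℤ m (λ c → F c r))) ≡ ∑ℤ m (λ c → detℤ n (setCol M s (F c)))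
detℤ-setCol-∑ n zero    M s F = detℤ-zero-column n _ s (setCol-same M s _)
detℤ-setCol-∑ n (suc m) M s F = trans (detℤ-setCol-+ n M s (F zero) (λ r → ∑ℤ m (λ c → F (suc c) r)))
  (cong (_+_ (detℤ n (setCol M s (F zero)))) (detℤ-setCol-∑ n m M s (F ∘ suc)))

mulVec : ∀ {m n} → (Fin m → Fin n → ℤ) → (Fin n → ℤ) → Fin m → ℤ
mulVec {n = n} A x r = ∑ℤ n (λ c → A r c * x c)

detℤ-add-columns : ∀ n (M : Matrix n) s (w : Fin n → ℤ) → w s ≡ + 1 → detℤ n (setCol M s (mulVec M w)) ≡ detℤ n M
detℤ-add-columns n M s w ws≡1 = begin
  detℤ n (setCol M s (mulVec M w))
    ≡⟨ detℤ-cong n (setCol-cong M s (λ r → ∑ℤ-cong n (λ c → ℤP.*-comm (M r c) (w c)))) ⟩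
  detℤ n (setCol M s (λ r → ∑ℤ n (λ c → w c * M r c)))         ≡⟨ detℤ-setCol-∑ n n M s (λ c r → w c * M r c) ⟩
  ∑ℤ n (λ c → detℤ n (setCol M s (λ r → w c * M r c)))         ≡⟨ ∑ℤ-cong n (λ c → detℤ-setCol-* n M s (w c) (λ r → M r c)) ⟩
  ∑ℤ n (λ c → w c * detℤ n (setCol M s (λ r → M r c)))         ≡⟨ ∑ℤ-single n _ s others ⟩
  w s * detℤ n (setCol M s (λ r → M r s))                       ≡⟨ cong₂ _*_ ws≡1 (detℤ-cong n (setCol-own-column M s)) ⟩
  + 1 * detℤ n M                                                ≡⟨ ℤP.*-identityˡ (detℤ n M) ⟩
  detℤ n M                                                      ∎
  where
  open ≡-Reasoning
  others : ∀ c → c ≢ s → w c * detℤ n (setCol M s (λ r → M r c)) ≡ + 0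
  others c c≢s = trans (cong (w c *_) (detℤ-copy-column n M (c≢s ∘ sym))) (ℤP.*-zeroʳ (w c))

detℤ-eigencolumn : ∀ n (M : Matrix n) s (w : Fin n → ℤ) t → w s ≡ + 1 → (∀ r → mulVec M w r ≡ t * w r) →
                   detℤ n M ≡ t * detℤ n (setCol M s w)
detℤ-eigencolumn n M s w t ws≡1 Mw≡tw = begin
  detℤ n M                                 ≡⟨ detℤ-add-columns n M s w ws≡1 ⟨
  detℤ n (setCol M s (mulVec M w))         ≡⟨ detℤ-cong n (setCol-cong M s Mw≡tw) ⟩
  detℤ n (setCol M s (λ r → t * w r))      ≡⟨ detℤ-setCol-* n M s t w ⟩
  t * detℤ n (setCol M s w)                ∎
  where open ≡-Reasoning

detℤ-column-operation : ∀ n (M : Matrix n) {s c} a b → s ≢ c →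
  detℤ n (setCol M s (λ r → a * M r s + b * M r c)) ≡ a * detℤ n M
detℤ-column-operation n M {s} {c} a b s≢c = begin
  detℤ n (setCol M s (λ r → a * M r s + b * M r c))
    ≡⟨ detℤ-setCol-+ n M s (λ r → a * M r s) (λ r → b * M r c) ⟩
  detℤ n (setCol M s (λ r → a * M r s)) + detℤ n (setCol M s (λ r → b * M r c))
    ≡⟨ cong₂ _+_ (detℤ-setCol-* n M s a (λ r → M r s)) (detℤ-setCol-* n M s b (λ r → M r c)) ⟩
  a * detℤ n (setCol M s (λ r → M r s)) + b * detℤ n (setCol M s (λ r → M r c))
    ≡⟨ cong₂ (λ x y → a * x + b * y) (detℤ-cong n (setCol-own-column M s)) (detℤ-copy-column n M s≢c) ⟩
  a * detℤ n M + b * + 0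
    ≡⟨ cong (_+_ (a * detℤ n M)) (ℤP.*-zeroʳ b) ⟩
  a * detℤ n M + + 0
    ≡⟨ ℤP.+-identityʳ _ ⟩
  a * detℤ n M  ∎
  where open ≡-Reasoning

detℤ-perturb : ∀ n (A B E : Matrix n) t → (∀ r c → A r c ≡ B r c + t * E r c) → ∃ λ z → detℤ n A ≡ detℤ n B + t * z
detℤ-perturb zero    A B E t A≡B+tE = + 0 , sym (cong (_+_ (+ 1)) (ℤP.*-zeroʳ t))
detℤ-perturb (suc n) A B E t A≡B+tE = ∑ℤ (suc n) z , (begin
  ∑ℤ (suc n) (expansionTerm A)                                   ≡⟨ ∑ℤ-cong (suc n) term ⟩
  ∑ℤ (suc n) (λ j → expansionTerm B j + t * z j)                 ≡⟨ ∑ℤ-distrib-+ (suc n) (expansionTerm B) (λ j → t * z j) ⟩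
  detℤ (suc n) B + ∑ℤ (suc n) (λ j → t * z j)                    ≡⟨ cong (_+_ (detℤ (suc n) B)) (*-distribˡ-∑ℤ (suc n) t z) ⟩
  detℤ (suc n) B + t * ∑ℤ (suc n) z                              ∎)
  where
  open ≡-Reasoning
  ih : ∀ j → ∃ λ z → detℤ n (minor A j) ≡ detℤ n (minor B j) + t * z
  ih j = detℤ-perturb n (minor A j) (minor B j) (minor E j) t (λ r c → A≡B+tE (suc r) (punchIn j c))
  z : Fin (suc n) → ℤ
  z j = altSign (toℕ j) * (E zero j * detℤ n (minor B j) + B zero j * proj₁ (ih j) + t * E zero j * proj₁ (ih j))
  term : ∀ j → expansionTerm A j ≡ expansionTerm B j + t * z j
  term j = trans (cong₂ (λ x y → altSign (toℕ j) * (x * y)) (A≡B+tE zero j) (proj₂ (ih j)))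
                 (expand (altSign (toℕ j)) (B zero j) (E zero j) t (detℤ n (minor B j)) (proj₁ (ih j)))
    where
    expand : ∀ s b e t d z → s * ((b + t * e) * (d + t * z)) ≡ s * (b * d) + t * (s * (e * d + b * z + t * e * z))
    expand = solve-∀

identityMatrix : ∀ n → Matrix n
identityMatrix n r c = if does (r ≟ c) then + 1 else + 0

detℤ-first-row-single : ∀ n (M : Matrix (suc n)) → (∀ j → M zero (suc j) ≡ + 0) →
                        detℤ (suc n) M ≡ M zero zero * detℤ n (minor M zero)
detℤ-first-row-single n M row≡0 = trans (cong (_+_ (+ 1 * (M zero zero * detℤ n (minor M zero))))
    (∑ℤ-zero n _ (λ j → trans (cong (λ x → altSign (toℕ (suc j)) * (x * detℤ n (minor M (suc j)))) (row≡0 j))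
                                (trans (cong (altSign (toℕ (suc j)) *_) (ℤP.*-zeroˡ (detℤ n (minor M (suc j)))))
                                       (ℤP.*-zeroʳ (altSign (toℕ (suc j))))))))
  (trans (ℤP.+-identityʳ _) (ℤP.*-identityˡ _))

detℤ-identity : ∀ n → detℤ n (identityMatrix n) ≡ + 1
detℤ-identity zero    = refl
detℤ-identity (suc n) = trans (detℤ-first-row-single n (identityMatrix (suc n)) (λ j → refl))
                              (trans (ℤP.*-identityˡ _) (detℤ-identity n))

vectorWithUnits : ∀ {n} → (Fin (suc n) → ℤ) → Fin (suc n) → Matrix (suc n)
vectorWithUnits v p r zero    = v r
vectorWithUnits v p r (suc c) = if does (r ≟ punchIn p c) then + 1 else + 0

detℤ-vectorWithUnits : ∀ n (v : Fin (suc n) → ℤ) p → detℤ (suc n) (vectorWithUnits v p) ≡ altSign (toℕ p) * v p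
detℤ-vectorWithUnits n       v zero    = trans (detℤ-first-row-single n (vectorWithUnits v zero) (λ j → refl))
  (trans (cong (v zero *_) (detℤ-identity n)) (trans (ℤP.*-identityʳ _) (sym (ℤP.*-identityˡ _))))
detℤ-vectorWithUnits (suc n) v (suc p) = begin
  expansionTerm T zero + (expansionTerm T (suc zero) + ∑ℤ n (λ j → expansionTerm T (suc (suc j))))
    ≡⟨ cong₂ (λ x y → x + (expansionTerm T (suc zero) + y)) first (∑ℤ-zero n _ rest) ⟩
  + 0 + (expansionTerm T (suc zero) + + 0)                       ≡⟨ ℤP.+-identityˡ _ ⟩
  expansionTerm T (suc zero) + + 0                               ≡⟨ ℤP.+-identityʳ _ ⟩
  - + 1 * (+ 1 * detℤ (suc n) (minor T (suc zero)))             ≡⟨ -1*1* _ ⟩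
  - detℤ (suc n) (minor T (suc zero))                            ≡⟨ cong -_ (detℤ-cong (suc n) minor₁) ⟩
  - detℤ (suc n) (vectorWithUnits (v ∘ suc) p)                   ≡⟨ cong -_ (detℤ-vectorWithUnits n (v ∘ suc) p) ⟩
  - (altSign (toℕ p) * v (suc p))                                ≡⟨ ℤP.neg-distribˡ-* (altSign (toℕ p)) (v (suc p)) ⟩
  altSign (toℕ (suc p)) * v (suc p)                              ∎
  where
  open ≡-Reasoning
  T : Matrix (suc (suc n))
  T = vectorWithUnits v (suc p)
  -1*1* : ∀ x → - + 1 * (+ 1 * x) ≡ - x
  -1*1* = solve-∀
  first : expansionTerm T zero ≡ + 0
  first = trans (cong (λ x → + 1 * (v zero * x)) (detℤ-zero-column (suc n) (minor T zero) zero (λ r → refl)))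
                (cong (+ 1 *_) (ℤP.*-zeroʳ (v zero)))
  rest : ∀ j → expansionTerm T (suc (suc j)) ≡ + 0
  rest j = trans (cong (altSign (toℕ (suc (suc j))) *_) (ℤP.*-zeroˡ (detℤ (suc n) (minor T (suc (suc j))))))
                 (ℤP.*-zeroʳ (altSign (toℕ (suc (suc j)))))
  minor₁ : ∀ r c → minor T (suc zero) r c ≡ vectorWithUnits (v ∘ suc) p r c
  minor₁ r zero    = refl
  minor₁ r (suc c) = refl

-- The top three coefficients of a characteristic polynomial

charMatrix : ∀ {n} → Matrix n → Fin n → Fin n → Poly
charMatrix M i j = if does (i ≟ j) then (- M i j) ∷ + 1 ∷ [] else (- M i j) ∷ []

charPoly : ∀ n → Matrix n → Poly
charPoly n M = det n (charMatrix M)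

tailMatrix : ∀ {n} → Matrix (suc n) → Matrix n
tailMatrix M r c = M (suc r) (suc c)

trace : ∀ n → Matrix n → ℤ
trace n M = ∑ℤ n (λ i → M i i)

-- The sum of the principal 2 × 2 minors.
σ₂ : ∀ n → Matrix n → ℤ
σ₂ zero    M = + 0
σ₂ (suc n) M = M zero zero * trace n (tailMatrix M) + σ₂ n (tailMatrix M) - ∑ℤ n (λ j → M zero (suc j) * M (suc j) zero)

altSign² : ∀ m → altSign m * altSign m ≡ + 1
altSign² zero    = refl
altSign² (suc m) = trans (neg² (altSign m)) (altSign² m)
  where
  neg² : ∀ a → - a * - a ≡ a * a
  neg² = solve-∀

charMatrix-degree : ∀ {n} (M : Matrix n) r c → DegreeAtMost (charMatrix M r c) 1
charMatrix-degree M r c i 1<i with does (r ≟ c)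
charMatrix-degree M r c (suc (suc i)) _        | true  = refl
charMatrix-degree M r c (suc zero)    (s≤s ()) | true
charMatrix-degree M r c (suc i)       _        | false = refl

charMatrix-leading : ∀ {n} (M : Matrix n) r c → coeff (charMatrix M r c) 1 ≡ identityMatrix n r c
charMatrix-leading M r c with does (r ≟ c)
... | true  = refl
... | false = refl

∑ℕ-ones : ∀ n → ∑ ℕ._+_ 0 n (λ _ → 1) ≡ n
∑ℕ-ones zero    = refl
∑ℕ-ones (suc n) = cong suc (∑ℕ-ones n)

charPoly-monic : ∀ n (M : Matrix n) → DegreeAtMost (charPoly n M) n × coeff (charPoly n M) n ≡ + 1
charPoly-monic n M = subst (DegreeAtMost (charPoly n M)) (∑ℕ-ones n) (proj₁ leading) ,
  trans (cong (coeff (charPoly n M)) (sym (∑ℕ-ones n)))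
        (trans (proj₂ leading) (trans (detℤ-cong n (charMatrix-leading M)) (detℤ-identity n)))
  where
  leading : DegreeAtMost (charPoly n M) (∑ ℕ._+_ 0 n (λ _ → 1)) ×
            coeff (charPoly n M) (∑ ℕ._+_ 0 n (λ _ → 1)) ≡ detℤ n (λ r c → coeff (charMatrix M r c) 1)
  leading = det-leading n (charMatrix M) (λ _ → 1) (charMatrix-degree M)

-- Column 0 of this minor of x I - M contains no diagonal entry, so it is constant.
cofactorPoly : ∀ {n} → Matrix (suc (suc n)) → Fin (suc n) → Poly
cofactorPoly {n} M j = det (suc n) (λ r c → charMatrix M (suc r) (punchIn (suc j) c))

cofactorPoly-leading : ∀ n (M : Matrix (suc (suc n))) j →
  DegreeAtMost (cofactorPoly M j) n × coeff (cofactorPoly M j) n ≡ altSign (toℕ j) * - M (suc j) zero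
cofactorPoly-leading n M j =
  subst (DegreeAtMost (cofactorPoly M j)) (∑ℕ-ones n) (proj₁ leading) ,
  trans (cong (coeff (cofactorPoly M j)) (sym (∑ℕ-ones n)))
    (trans (proj₂ leading) (trans (detℤ-cong (suc n) units) (detℤ-vectorWithUnits n (λ r → - M (suc r) zero) j)))
  where
  N : Fin (suc n) → Fin (suc n) → Poly
  N r c = charMatrix M (suc r) (punchIn (suc j) c)
  columnDegree : Fin (suc n) → ℕ
  columnDegree zero    = 0
  columnDegree (suc c) = 1
  N≤ : ∀ r c → DegreeAtMost (N r c) (columnDegree c)
  N≤ r zero    (suc i) _ = refl
  N≤ r (suc c)           = charMatrix-degree M (suc r) (suc (punchIn j c))
  leading : DegreeAtMost (cofactorPoly M j) (∑ ℕ._+_ 0 (suc n) columnDegree) ×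
            coeff (cofactorPoly M j) (∑ ℕ._+_ 0 (suc n) columnDegree) ≡ detℤ (suc n) (λ r c → coeff (N r c) (columnDegree c))
  leading = det-leading (suc n) N columnDegree N≤
  units : ∀ r c → coeff (N r c) (columnDegree c) ≡ vectorWithUnits (λ r → - M (suc r) zero) j r c
  units r zero    = refl
  units r (suc c) = charMatrix-leading M (suc r) (suc (punchIn j c))

charPoly-expand : ∀ n (M : Matrix (suc (suc n))) i → coeff (charPoly (suc (suc n)) M) i ≡
  coeff (((- M zero zero) ∷ + 1 ∷ []) *P charPoly (suc n) (tailMatrix M)) i +
  ∑ℤ (suc n) (λ j → - altSign (toℕ j) * (- M zero (suc j) * coeff (cofactorPoly M j) i))
charPoly-expand n M i =
  trans (coeff-∑P (suc (suc n)) (λ j → scaleP (altSign (toℕ j)) (charMatrix M zero j *P det (suc n) (minorP j))) i) (cong₂ _+_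
  (trans (coeff-scaleP (+ 1) (((- M zero zero) ∷ + 1 ∷ []) *P charPoly (suc n) (tailMatrix M)) i) (ℤP.*-identityˡ _))
  (∑ℤ-cong (suc n) (λ j → trans (coeff-scaleP (- altSign (toℕ j)) (((- M zero (suc j)) ∷ []) *P cofactorPoly M j) i)
                                 (cong (- altSign (toℕ j) *_) (coeff-[a]*P (- M zero (suc j)) (cofactorPoly M j) i)))))
  where
  minorP : Fin (suc (suc n)) → Fin (suc n) → Fin (suc n) → Poly
  minorP j r c = charMatrix M (suc r) (punchIn j c)

charPoly-coeff-trace : ∀ n (M : Matrix (suc n)) → coeff (charPoly (suc n) M) n ≡ - trace (suc n) M
charPoly-coeff-trace zero M = trans (coeff-∑P 1 (λ j → scaleP (+ 1) P) 0) (trans (ℤP.+-identityʳ _) (trans (coeff-scaleP (+ 1) P 0)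
  (trans (ℤP.*-identityˡ _) (trans (coeff₀-linear*P (- M zero zero) (+ 1 ∷ [])) (simplify (M zero zero))))))
  where
  P : Poly
  P = ((- M zero zero) ∷ + 1 ∷ []) *P (+ 1 ∷ [])
  simplify : ∀ a → - a * + 1 ≡ - (a + + 0)
  simplify = solve-∀
charPoly-coeff-trace (suc n) M = trans (charPoly-expand n M (suc n)) (trans (cong₂ _+_
    (trans (coeff-linear*P (- M zero zero) (charPoly (suc n) (tailMatrix M)) n)
           (cong₂ (λ x y → - M zero zero * x + y) (proj₂ (charPoly-monic (suc n) (tailMatrix M)))
                                                   (charPoly-coeff-trace n (tailMatrix M))))
    (∑ℤ-zero (suc n) _ (λ j → trans
      (cong (λ x → - altSign (toℕ j) * (- M zero (suc j) * x)) (proj₁ (cofactorPoly-leading n M j) (suc n) ℕP.≤-refl))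
      (vanish (altSign (toℕ j)) (M zero (suc j))))))
  (simplify (M zero zero) (trace (suc n) (tailMatrix M))))
  where
  simplify : ∀ a t → - a * + 1 + - t + + 0 ≡ - (a + t)
  simplify = solve-∀
  vanish : ∀ s a → - s * (- a * + 0) ≡ + 0
  vanish = solve-∀

charPoly-coeff-σ₂ : ∀ n (M : Matrix (suc (suc n))) → coeff (charPoly (suc (suc n)) M) n ≡ σ₂ (suc (suc n)) M
charPoly-coeff-σ₂ n M = trans (charPoly-expand n M n) (cong₂ _+_ (diagonalPart n M) offDiagonalPart)
  where
  offDiagonalPart : ∑ℤ (suc n) (λ j → - altSign (toℕ j) * (- M zero (suc j) * coeff (cofactorPoly M j) n)) ≡
                    - ∑ℤ (suc n) (λ j → M zero (suc j) * M (suc j) zero)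
  offDiagonalPart = trans (∑ℤ-cong (suc n) (λ j → begin
      - altSign (toℕ j) * (- M zero (suc j) * coeff (cofactorPoly M j) n)
        ≡⟨ cong (λ x → - altSign (toℕ j) * (- M zero (suc j) * x)) (proj₂ (cofactorPoly-leading n M j)) ⟩
      - altSign (toℕ j) * (- M zero (suc j) * (altSign (toℕ j) * - M (suc j) zero))
        ≡⟨ regroup (altSign (toℕ j)) (M zero (suc j)) (M (suc j) zero) ⟩
      - (altSign (toℕ j) * altSign (toℕ j) * (M zero (suc j) * M (suc j) zero))
        ≡⟨ cong (λ s → - (s * (M zero (suc j) * M (suc j) zero))) (altSign² (toℕ j)) ⟩
      - (+ 1 * (M zero (suc j) * M (suc j) zero))
        ≡⟨ cong -_ (ℤP.*-identityˡ _) ⟩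
      - (M zero (suc j) * M (suc j) zero)  ∎))
    (∑ℤ-neg (suc n) (λ j → M zero (suc j) * M (suc j) zero))
    where
    open ≡-Reasoning
    regroup : ∀ s a b → - s * (- a * (s * - b)) ≡ - (s * s * (a * b))
    regroup = solve-∀
  diagonalPart : ∀ n (M : Matrix (suc (suc n))) →
    coeff (((- M zero zero) ∷ + 1 ∷ []) *P charPoly (suc n) (tailMatrix M)) n ≡
    M zero zero * trace (suc n) (tailMatrix M) + σ₂ (suc n) (tailMatrix M)
  diagonalPart zero M = trans (coeff₀-linear*P (- M zero zero) (charPoly 1 (tailMatrix M)))
    (trans (cong (- M zero zero *_) (charPoly-coeff-trace zero (tailMatrix M)))
           (simplify (M zero zero) (trace 1 (tailMatrix M)) (M (suc zero) (suc zero))))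
    where
    simplify : ∀ a t b → - a * - t ≡ a * t + (b * + 0 + + 0 - + 0)
    simplify = solve-∀
  diagonalPart (suc n) M = trans (coeff-linear*P (- M zero zero) (charPoly (suc (suc n)) (tailMatrix M)) n)
    (trans (cong₂ (λ x y → - M zero zero * x + y) (charPoly-coeff-trace (suc n) (tailMatrix M))
                                                  (charPoly-coeff-σ₂ n (tailMatrix M)))
           (simplify (M zero zero) _ _))
    where
    simplify : ∀ a t s → - a * - t + s ≡ a * t + s
    simplify = solve-∀

traceOfSquare : ∀ n → Matrix n → ℤ
traceOfSquare n M = ∑ℤ n (λ i → ∑ℤ n (λ j → M i j * M j i))

two-σ₂ : ∀ n (M : Matrix n) → + 2 * σ₂ n M ≡ trace n M * trace n M - traceOfSquare n M
two-σ₂ zero    M = refl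
two-σ₂ (suc n) M = begin
  + 2 * (a * t + s - X)                               ≡⟨ expand a t s X ⟩
  + 2 * a * t + + 2 * s - + 2 * X                     ≡⟨ cong (λ y → + 2 * a * t + y - + 2 * X) (two-σ₂ n (tailMatrix M)) ⟩
  + 2 * a * t + (t * t - Q) - + 2 * X                 ≡⟨ complete a t Q X ⟩
  (a + t) * (a + t) - (a * a + X + (X + Q))           ≡⟨ cong (λ y → (a + t) * (a + t) - (a * a + X + (y + Q))) X′≡X ⟨
  (a + t) * (a + t) - (a * a + X + (X′ + Q))          ≡⟨ cong (λ y → (a + t) * (a + t) - (a * a + X + y)) (∑ℤ-distrib-+ n _ _) ⟨
  trace (suc n) M * trace (suc n) M - traceOfSquare (suc n) M  ∎
  where
  open ≡-Reasoning
  a t s Q X X′ : ℤ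
  a = M zero zero
  t = trace n (tailMatrix M)
  s = σ₂ n (tailMatrix M)
  Q = traceOfSquare n (tailMatrix M)
  X = ∑ℤ n (λ j → M zero (suc j) * M (suc j) zero)
  X′ = ∑ℤ n (λ i → M (suc i) zero * M zero (suc i))
  X′≡X : X′ ≡ X
  X′≡X = ∑ℤ-cong n (λ i → ℤP.*-comm (M (suc i) zero) (M zero (suc i)))
  expand : ∀ a t s X → + 2 * (a * t + s - X) ≡ + 2 * a * t + + 2 * s - + 2 * X
  expand = solve-∀
  complete : ∀ a t q X → + 2 * a * t + (t * t - q) - + 2 * X ≡ (a + t) * (a + t) - (a * a + X + (X + q))
  complete = solve-∀

-- Graph Laplacians

module _ {n : ℕ} (G : Graph n) where

  adjℤ : Fin n → Fin n → ℤ
  adjℤ i j = if adj G i j then + 1 else + 0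

  degreeℤ : Fin n → ℤ
  degreeℤ i = + degree G i

  degreeℤ-∑ : ∀ i → degreeℤ i ≡ ∑ℤ n (adjℤ i)
  degreeℤ-∑ i = trans (∑ℕ-+ n _) (∑ℤ-cong n (λ j → cast (adj G i j)))
    where
    cast : ∀ b → + (if b then 1 else 0) ≡ (if b then + 1 else + 0)
    cast true  = refl
    cast false = refl

  adjℤ-sym : ∀ i j → adjℤ i j ≡ adjℤ j i
  adjℤ-sym i j = cong (if_then + 1 else + 0) (Graph.sym G i j)

  laplacian-diagonal : ∀ i → laplacian G i i ≡ degreeℤ i
  laplacian-diagonal i rewrite dec-true (i ≟ i) refl | irrefl G i = ℤP.+-identityʳ _

  laplacian-offDiagonal : ∀ {i j} → i ≢ j → laplacian G i j ≡ - adjℤ i j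
  laplacian-offDiagonal {i} {j} i≢j rewrite dec-false (i ≟ j) i≢j = ℤP.+-identityˡ _

  laplacian-sym : ∀ i j → laplacian G i j ≡ laplacian G j i
  laplacian-sym i j = byCases (i ≟ j)
    where
    byCases : Dec (i ≡ j) → laplacian G i j ≡ laplacian G j i
    byCases (yes i≡j) = cong₂ (laplacian G) i≡j (sym i≡j)
    byCases (no i≢j)  = trans (laplacian-offDiagonal i≢j)
                          (trans (cong -_ (adjℤ-sym i j)) (sym (laplacian-offDiagonal (i≢j ∘ sym))))

  trace-laplacian : trace n (laplacian G) ≡ ∑ℤ n degreeℤ
  trace-laplacian = ∑ℤ-cong n laplacian-diagonal

  traceOfSquare-laplacian : traceOfSquare n (laplacian G) ≡ ∑ℤ n (λ i → degreeℤ i * degreeℤ i) + ∑ℤ n degreeℤ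
  traceOfSquare-laplacian = trans (∑ℤ-cong n row) (∑ℤ-distrib-+ n _ _)
    where
    entry : ∀ i j → laplacian G i j * laplacian G j i ≡ (if does (j ≟ i) then degreeℤ i * degreeℤ i else + 0) + adjℤ i j
    entry i j = byCases (j ≟ i)
      where
      byCases : (d : Dec (j ≡ i)) →
                laplacian G i j * laplacian G j i ≡ (if does d then degreeℤ i * degreeℤ i else + 0) + adjℤ i j
      byCases (yes refl) = begin
          laplacian G j j * laplacian G j j  ≡⟨ cong (λ d → d * d) (laplacian-diagonal j) ⟩
        degreeℤ j * degreeℤ j              ≡⟨ ℤP.+-identityʳ _ ⟨
        degreeℤ j * degreeℤ j + + 0        ≡⟨ cong (λ b → degreeℤ j * degreeℤ j + (if b then + 1 else + 0)) (irrefl G j) ⟨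
        degreeℤ j * degreeℤ j + adjℤ j j   ∎
        where open ≡-Reasoning
      byCases (no j≢i) = begin
        laplacian G i j * laplacian G j i  ≡⟨ cong₂ _*_ (laplacian-offDiagonal (j≢i ∘ sym)) (laplacian-offDiagonal j≢i) ⟩
        - adjℤ i j * - adjℤ j i            ≡⟨ cong (λ a → - adjℤ i j * - a) (adjℤ-sym j i) ⟩
        - adjℤ i j * - adjℤ i j            ≡⟨ idempotent (adj G i j) ⟩
        adjℤ i j                           ≡⟨ ℤP.+-identityˡ _ ⟨
        + 0 + adjℤ i j                     ∎
        where
        open ≡-Reasoning
        idempotent : ∀ b → let a = if b then + 1 else + 0 in - a * - a ≡ a
        idempotent true  = refl
        idempotent false = refl
    row : ∀ i → ∑ℤ n (λ j → laplacian G i j * laplacian G j i) ≡ degreeℤ i * degreeℤ i + degreeℤ i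
    row i = trans (∑ℤ-cong n (entry i)) (trans (∑ℤ-distrib-+ n _ _)
                  (cong₂ _+_ (∑ℤ-indicator n i (degreeℤ i * degreeℤ i)) (sym (degreeℤ-∑ i))))

laplacianCharPoly-coeff-degreeSum : ∀ m (G : Graph (suc (suc m))) →
  coeff (laplacianCharPoly G) (suc m) ≡ - ∑ℤ (suc (suc m)) (degreeℤ G)
laplacianCharPoly-coeff-degreeSum m G = trans (charPoly-coeff-trace (suc m) (laplacian G)) (cong -_ (trace-laplacian G))

laplacianCharPoly-coeff-degreeSquares : ∀ m (G : Graph (suc (suc m))) →
  let D = ∑ℤ (suc (suc m)) (degreeℤ G) in
  + 2 * coeff (laplacianCharPoly G) m ≡ D * D - (∑ℤ (suc (suc m)) (λ i → degreeℤ G i * degreeℤ G i) + D)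
laplacianCharPoly-coeff-degreeSquares m G =
  trans (cong (+ 2 *_) (charPoly-coeff-σ₂ m (laplacian G))) (trans (two-σ₂ _ (laplacian G))
        (cong₂ (λ t q → t * t - q) (trace-laplacian G) (traceOfSquare-laplacian G)))

-- Integer kernels of singular matrices

InKernel : ∀ {m n} → (Fin m → Fin n → ℤ) → (Fin n → ℤ) → Set
InKernel A x = ∀ r → mulVec A x r ≡ + 0

Nontrivial : ∀ {n} → (Fin n → ℤ) → Set
Nontrivial {n} x = Σ (Fin n) λ i → x i ≢ + 0

HasKernelVector : ∀ {m n} → (Fin m → Fin n → ℤ) → Set
HasKernelVector {n = n} A = Σ (Fin n → ℤ) λ x → InKernel A x × Nontrivial x

firstRow-zero-or-pivot : ∀ {m n} (A : Fin (suc m) → Fin n → ℤ) →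
                         (∀ c → A zero c ≡ + 0) ⊎ Σ (Fin n) (λ j → A zero j ≢ + 0)
firstRow-zero-or-pivot {n = n} A with all? (λ c → A zero c ℤP.≟ + 0)
... | yes row≡0 = inj₁ row≡0
... | no ¬row≡0 = inj₂ (¬∀⟶∃¬ n _ (λ c → A zero c ℤP.≟ + 0) ¬row≡0)

hasKernelVector-zeroRow : ∀ {m n} (A : Fin (suc m) → Fin n → ℤ) → (∀ c → A zero c ≡ + 0) →
                          HasKernelVector (A ∘ suc) → HasKernelVector A
hasKernelVector-zeroRow {n = n} A row≡0 (x , x∈ker , nontrivial) = x , x∈ker′ , nontrivial
  where
  x∈ker′ : InKernel A x
  x∈ker′ zero    = ∑ℤ-zero n _ (λ c → trans (cong (_* x c) (row≡0 c)) (ℤP.*-zeroˡ (x c)))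
  x∈ker′ (suc r) = x∈ker r

hasKernelVector-swap : ∀ {m n} (A : Fin m → Fin n → ℤ) i j →
                       HasKernelVector (λ r c → A r (PC.transpose i j c)) → HasKernelVector A
hasKernelVector-swap {n = n} A i j (x , x∈ker , (l , xl≢0)) =
  x ∘ PC.transpose j i , x∈ker′ , (PC.transpose i j l , xl≢0 ∘ trans (sym (cong x (PC.transpose-inverse j i))))
  where
  x∈ker′ : InKernel A (x ∘ PC.transpose j i)
  x∈ker′ r = trans (sym (∑ℤ-transpose n i j (λ c → A r c * x (PC.transpose j i c))))
    (trans (∑ℤ-cong n (λ c → cong (λ k → A r (PC.transpose i j c) * x k) (PC.transpose-inverse j i))) (x∈ker r))

-- One step of fraction-free Gaussian elimination with pivot A 0 0.
module Elimination {m n : ℕ} (A : Fin (suc m) → Fin (suc n) → ℤ) where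

  pivot : ℤ
  pivot = A zero zero

  reduced : Fin m → Fin n → ℤ
  reduced r c = pivot * A (suc r) (suc c) - A (suc r) zero * A zero (suc c)

  lift : (Fin n → ℤ) → Fin (suc n) → ℤ
  lift y zero    = - ∑ℤ n (λ c → A zero (suc c) * y c)
  lift y (suc c) = pivot * y c

  mulVec-lift : ∀ y r → mulVec A (lift y) r ≡ ∑ℤ n (λ c → (pivot * A r (suc c) - A r zero * A zero (suc c)) * y c)
  mulVec-lift y r = begin
    A r zero * - ∑ℤ n (λ c → A zero (suc c) * y c) + ∑ℤ n (λ c → A r (suc c) * (pivot * y c))
      ≡⟨ swap (A r zero) _ _ ⟩
    ∑ℤ n (λ c → A r (suc c) * (pivot * y c)) - A r zero * ∑ℤ n (λ c → A zero (suc c) * y c)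
      ≡⟨ cong (_-_ (∑ℤ n (λ c → A r (suc c) * (pivot * y c)))) (*-distribˡ-∑ℤ n (A r zero) _) ⟨
    ∑ℤ n (λ c → A r (suc c) * (pivot * y c)) - ∑ℤ n (λ c → A r zero * (A zero (suc c) * y c))
      ≡⟨ ∑ℤ-distrib-- n _ _ ⟨
    ∑ℤ n (λ c → A r (suc c) * (pivot * y c) - A r zero * (A zero (suc c) * y c))
      ≡⟨ ∑ℤ-cong n (λ c → factor (A r (suc c)) pivot (y c) (A r zero) (A zero (suc c))) ⟩
    ∑ℤ n (λ c → (pivot * A r (suc c) - A r zero * A zero (suc c)) * y c)  ∎
    where
    open ≡-Reasoning
    swap : ∀ p u v → p * - u + v ≡ v - p * u
    swap = solve-∀
    factor : ∀ x a y p q → x * (a * y) - p * (q * y) ≡ (a * x - p * q) * y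
    factor = solve-∀

  lift-kernel : pivot ≢ + 0 → HasKernelVector reduced → HasKernelVector A
  lift-kernel pivot≢0 (y , y∈ker , (i , yi≢0)) = lift y , lift∈ker , (suc i , pivot*yi≢0)
    where
    lift∈ker : InKernel A (lift y)
    lift∈ker zero    = trans (mulVec-lift y zero)
      (∑ℤ-zero n _ (λ c → trans (cong (_* y c) (cancel pivot (A zero (suc c)))) (ℤP.*-zeroˡ (y c))))
      where
      cancel : ∀ a q → a * q - a * q ≡ + 0
      cancel = solve-∀
    lift∈ker (suc r) = trans (mulVec-lift y (suc r)) (y∈ker r)
    pivot*yi≢0 : pivot * y i ≢ + 0
    pivot*yi≢0 e with ℤP.i*j≡0⇒i≡0∨j≡0 pivot e
    ... | inj₁ pivot≡0 = pivot≢0 pivot≡0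
    ... | inj₂ yi≡0    = yi≢0 yi≡0

swap-pivot : ∀ {m n} (A : Fin (suc m) → Fin (suc n) → ℤ) {j} → A zero j ≢ + 0 → A zero (PC.transpose zero j zero) ≢ + 0
swap-pivot A {j} A0j≢0 = A0j≢0 ∘ trans (cong (A zero) (sym (transpose-left zero j)))

fewer-rows⇒kernelVector : ∀ m n (A : Fin m → Fin n → ℤ) → m ℕ.< n → HasKernelVector A
fewer-rows⇒kernelVector zero    (suc n) A _ = (λ _ → + 1) , (λ ()) , (zero , λ ())
fewer-rows⇒kernelVector (suc m) (suc n) A (s≤s m<n) with firstRow-zero-or-pivot A
... | inj₁ row≡0 = hasKernelVector-zeroRow A row≡0 (fewer-rows⇒kernelVector m (suc n) (A ∘ suc) (ℕP.m≤n⇒m≤1+n m<n))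
... | inj₂ (j , A0j≢0) = hasKernelVector-swap A zero j
  (Elimination.lift-kernel A′ (swap-pivot A A0j≢0) (fewer-rows⇒kernelVector m n (Elimination.reduced A′) m<n))
  where
  A′ : Fin (suc m) → Fin (suc n) → ℤ
  A′ r c = A r (PC.transpose zero j c)

-- Eliminating the first row one column at a time, each column operation scales the determinant by the pivot.
module SchurComplement {n : ℕ} (M : Matrix (suc n)) where
  open Elimination M using (pivot; reduced)

  partiallyReduced : ℕ → Matrix (suc n)
  partiallyReduced k r zero    = M r zero
  partiallyReduced k r (suc c) =
    if toℕ c ℕ.<ᵇ k then pivot * M r (suc c) - M r zero * M zero (suc c) else M r (suc c)

  partiallyReduced-zero : ∀ r c → partiallyReduced 0 r c ≡ M r c
  partiallyReduced-zero r zero    = refl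
  partiallyReduced-zero r (suc c) = refl

  partiallyReduced-step : ∀ k (k<n : k ℕ.< n) r c → let s = suc (fromℕ< k<n) in
    partiallyReduced (suc k) r c ≡
    setCol (partiallyReduced k) s (λ r → pivot * partiallyReduced k r s + (- M zero s) * partiallyReduced k r zero) r c
  partiallyReduced-step k k<n r zero = refl
  partiallyReduced-step k k<n r (suc c) with c ≟ fromℕ< k<n
  ... | yes refl
    with toℕ c ℕ.<ᵇ suc k | ℕP.<ᵇ-reflects-< (toℕ c) (suc k) | toℕ c ℕ.<ᵇ k | ℕP.<ᵇ-reflects-< (toℕ c) k
  ...   | false | ofⁿ c≮k+1 | _    | _        = ⊥-elim (c≮k+1 (s≤s (ℕP.≤-reflexive (toℕ-fromℕ< k<n))))
  ...   | true  | _         | true | ofʸ c<k  = ⊥-elim (ℕP.<-irrefl (toℕ-fromℕ< k<n) c<k)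
  ...   | true  | _         | false | _       = rearrange pivot (M r (suc c)) (M r zero) (M zero (suc c))
    where
    rearrange : ∀ a x m b → a * x - m * b ≡ a * x + - b * m
    rearrange = solve-∀
  partiallyReduced-step k k<n r (suc c) | no c≢k
    with toℕ c ℕ.<ᵇ suc k | ℕP.<ᵇ-reflects-< (toℕ c) (suc k) | toℕ c ℕ.<ᵇ k | ℕP.<ᵇ-reflects-< (toℕ c) k
  ... | true  | _           | true  | _       = refl
  ... | false | _           | false | _       = refl
  ... | true  | ofʸ c<k+1   | false | ofⁿ c≮k =
    ⊥-elim (c≮k (ℕP.≤∧≢⇒< (ℕP.≤-pred c<k+1) (c≢k ∘ λ e → toℕ-injective (trans e (sym (toℕ-fromℕ< k<n))))))
  ... | false | ofⁿ c≮k+1   | true  | ofʸ c<k = ⊥-elim (c≮k+1 (ℕP.m≤n⇒m≤1+n c<k))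

  detℤ-partiallyReduced : ∀ k → k ℕ.≤ n → detℤ (suc n) (partiallyReduced k) ≡ pivot ^ k * detℤ (suc n) M
  detℤ-partiallyReduced zero    _   = trans (detℤ-cong (suc n) partiallyReduced-zero) (sym (ℤP.*-identityˡ _))
  detℤ-partiallyReduced (suc k) k<n = begin
    detℤ (suc n) (partiallyReduced (suc k))                   ≡⟨ detℤ-cong (suc n) (partiallyReduced-step k k<n) ⟩
    detℤ (suc n) (setCol (partiallyReduced k) s column)
      ≡⟨ detℤ-column-operation (suc n) (partiallyReduced k) {s} {zero} pivot (- M zero s) (λ ()) ⟩
    pivot * detℤ (suc n) (partiallyReduced k)                 ≡⟨ cong (pivot *_) (detℤ-partiallyReduced k (ℕP.<⇒≤ k<n)) ⟩
    pivot * (pivot ^ k * detℤ (suc n) M)                      ≡⟨ ℤP.*-assoc pivot (pivot ^ k) _ ⟨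
    pivot ^ suc k * detℤ (suc n) M                            ∎
    where
    open ≡-Reasoning
    s : Fin (suc n)
    s = suc (fromℕ< k<n)
    column : Fin (suc n) → ℤ
    column r = pivot * partiallyReduced k r s + (- M zero s) * partiallyReduced k r zero

  fullyReduced-firstRow : ∀ c → partiallyReduced n zero (suc c) ≡ + 0
  fullyReduced-firstRow c with toℕ c ℕ.<ᵇ n | ℕP.<ᵇ-reflects-< (toℕ c) n
  ... | true  | _      = cancel pivot (M zero (suc c))
    where
    cancel : ∀ a b → a * b - a * b ≡ + 0
    cancel = solve-∀
  ... | false | ofⁿ c≮n = ⊥-elim (c≮n (toℕ<n c))

  fullyReduced-minor : ∀ r c → minor (partiallyReduced n) zero r c ≡ reduced r c
  fullyReduced-minor r c with toℕ c ℕ.<ᵇ n | ℕP.<ᵇ-reflects-< (toℕ c) n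
  ... | true  | _      = refl
  ... | false | ofⁿ c≮n = ⊥-elim (c≮n (toℕ<n c))

  detℤ-schur : pivot ^ n * detℤ (suc n) M ≡ pivot * detℤ n reduced
  detℤ-schur = begin
    pivot ^ n * detℤ (suc n) M                            ≡⟨ detℤ-partiallyReduced n ℕP.≤-refl ⟨
    detℤ (suc n) (partiallyReduced n)                     ≡⟨ detℤ-first-row-single n (partiallyReduced n) fullyReduced-firstRow ⟩
    pivot * detℤ n (minor (partiallyReduced n) zero)      ≡⟨ cong (pivot *_) (detℤ-cong n fullyReduced-minor) ⟩
    pivot * detℤ n reduced                                ∎
    where open ≡-Reasoning

transpose-same : ∀ {n} (i k : Fin n) → PC.transpose i i k ≡ k
transpose-same i k with k ≟ i
... | yes k≡i = sym k≡i
... | no k≢i rewrite dec-false (k ≟ i) k≢i = refl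

detℤ≡0⇒kernelVector : ∀ n (M : Matrix n) → detℤ n M ≡ + 0 → HasKernelVector M
detℤ≡0⇒kernelVector zero    M ()
detℤ≡0⇒kernelVector (suc n) M det≡0 with firstRow-zero-or-pivot M
... | inj₁ row≡0 = hasKernelVector-zeroRow M row≡0 (fewer-rows⇒kernelVector n (suc n) (M ∘ suc) ℕP.≤-refl)
... | inj₂ (j , M0j≢0) = hasKernelVector-swap M zero j
  (Elimination.lift-kernel M′ pivot≢0 (detℤ≡0⇒kernelVector n (Elimination.reduced M′) reduced≡0))
  where
  M′ : Matrix (suc n)
  M′ r c = M r (PC.transpose zero j c)
  open Elimination M′ using (pivot)
  pivot≢0 : pivot ≢ + 0
  pivot≢0 = swap-pivot M M0j≢0
  M′≡0 : detℤ (suc n) M′ ≡ + 0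
  M′≡0 with zero ≟ j
  ... | yes refl = trans (detℤ-cong (suc n) (λ r c → cong (M r) (transpose-same zero c))) det≡0
  ... | no 0≢j   = trans (detℤ-swap-columns (suc n) M 0≢j) (cong -_ det≡0)
  reduced≡0 : detℤ n (Elimination.reduced M′) ≡ + 0
  reduced≡0 with ℤP.i*j≡0⇒i≡0∨j≡0 pivot
                   (trans (sym (SchurComplement.detℤ-schur M′)) (trans (cong (pivot ^ n *_) M′≡0) (ℤP.*-zeroʳ (pivot ^ n))))
  ... | inj₁ pivot≡0 = ⊥-elim (pivot≢0 pivot≡0)
  ... | inj₂ det≡0′  = det≡0′

-- The Laplacian spectrum detects connectivity

eval-charMatrix : ∀ {n} (M : Matrix n) t r c → eval (charMatrix M r c) t ≡ t * identityMatrix n r c - M r c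
eval-charMatrix M t r c with does (r ≟ c)
... | true  = linear (M r c) t
  where
  linear : ∀ m t → - m + t * (+ 1 + t * + 0) ≡ t * + 1 - m
  linear = solve-∀
... | false = constant (M r c) t
  where
  constant : ∀ m t → - m + t * + 0 ≡ t * + 0 - m
  constant = solve-∀

mulVec-identity : ∀ n (y : Fin n → ℤ) i → mulVec (identityMatrix n) y i ≡ y i
mulVec-identity n y i = trans (∑ℤ-single n _ i off) (trans (cong (λ b → (if b then + 1 else + 0) * y i) (dec-true (i ≟ i) refl))
                                                         (ℤP.*-identityˡ (y i)))
  where
  off : ∀ c → c ≢ i → identityMatrix n i c * y c ≡ + 0
  off c c≢i rewrite dec-false (i ≟ c) (c≢i ∘ sym) = refl

module _ {n : ℕ} (G : Graph n) where

  shiftedLaplacian : ℤ → Matrix n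
  shiftedLaplacian t r c = t * identityMatrix n r c - laplacian G r c

  eval-laplacianCharPoly : ∀ t → eval (laplacianCharPoly G) t ≡ detℤ n (shiftedLaplacian t)
  eval-laplacianCharPoly t = trans (eval-det n _ t) (detℤ-cong n (eval-charMatrix (laplacian G) t))

  laplacian-apply : ∀ (y : Fin n → ℤ) i → mulVec (laplacian G) y i ≡ ∑ℤ n (λ c → adjℤ G i c * (y i - y c))
  laplacian-apply y i = begin
    ∑ℤ n (λ c → laplacian G i c * y c)                    ≡⟨ ∑ℤ-cong n (λ c → split (δ c) (adjℤ G i c) (y c)) ⟩
    ∑ℤ n (λ c → δ c * y c - adjℤ G i c * y c)             ≡⟨ ∑ℤ-distrib-- n (λ c → δ c * y c) ay ⟩
    ∑ℤ n (λ c → δ c * y c) - ∑ℤ n ay                      ≡⟨ cong (_- ∑ℤ n ay) diagonal ⟩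
    degreeℤ G i * y i - ∑ℤ n ay                           ≡⟨ cong (λ d → d * y i - ∑ℤ n ay) (degreeℤ-∑ G i) ⟩
    ∑ℤ n (adjℤ G i) * y i - ∑ℤ n ay                       ≡⟨ cong (_- ∑ℤ n ay) (*-distribʳ-∑ℤ n (y i) (adjℤ G i)) ⟨
    ∑ℤ n (λ c → adjℤ G i c * y i) - ∑ℤ n ay               ≡⟨ ∑ℤ-distrib-- n (λ c → adjℤ G i c * y i) ay ⟨
    ∑ℤ n (λ c → adjℤ G i c * y i - adjℤ G i c * y c)      ≡⟨ ∑ℤ-cong n (λ c → factor (adjℤ G i c) (y i) (y c)) ⟩
    ∑ℤ n (λ c → adjℤ G i c * (y i - y c))                 ∎
    where
    open ≡-Reasoning
    ay : Fin n → ℤ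
    ay c = adjℤ G i c * y c
    δ : Fin n → ℤ
    δ c = if does (i ≟ c) then degreeℤ G i else + 0
    split : ∀ d a y → (d - a) * y ≡ d * y - a * y
    split = solve-∀
    factor : ∀ a u v → a * u - a * v ≡ a * (u - v)
    factor = solve-∀
    diagonal : ∑ℤ n (λ c → δ c * y c) ≡ degreeℤ G i * y i
    diagonal = trans (∑ℤ-single n _ i off) (cong (λ b → (if b then degreeℤ G i else + 0) * y i) (dec-true (i ≟ i) refl))
      where
      off : ∀ c → c ≢ i → δ c * y c ≡ + 0
      off c c≢i rewrite dec-false (i ≟ c) (c≢i ∘ sym) = refl

  ConstantOnEdges : (Fin n → ℤ) → Set
  ConstantOnEdges w = ∀ r c → adj G r c ≡ true → w r ≡ w c

  laplacian-constantOnEdges : ∀ {w} → ConstantOnEdges w → ∀ i → mulVec (laplacian G) w i ≡ + 0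
  laplacian-constantOnEdges {w} const i = trans (laplacian-apply w i) (∑ℤ-zero n _ edge)
    where
    edge : ∀ c → adjℤ G i c * (w i - w c) ≡ + 0
    edge c with adj G i c in e
    ... | true  = trans (ℤP.*-identityˡ _) (ℤP.i≡j⇒i-j≡0 (const i c e))
    ... | false = refl

  shiftedLaplacian-apply : ∀ t (y : Fin n → ℤ) i → mulVec (shiftedLaplacian t) y i ≡ t * y i - mulVec (laplacian G) y i
  shiftedLaplacian-apply t y i = begin
    ∑ℤ n (λ c → (t * identityMatrix n i c - laplacian G i c) * y c)
      ≡⟨ ∑ℤ-cong n (λ c → split t (identityMatrix n i c) (laplacian G i c) (y c)) ⟩
    ∑ℤ n (λ c → t * (identityMatrix n i c * y c) - laplacian G i c * y c)
      ≡⟨ ∑ℤ-distrib-- n _ _ ⟩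
    ∑ℤ n (λ c → t * (identityMatrix n i c * y c)) - mulVec (laplacian G) y i
      ≡⟨ cong (_- mulVec (laplacian G) y i) (trans (*-distribˡ-∑ℤ n t _) (cong (t *_) (mulVec-identity n y i))) ⟩
    t * y i - mulVec (laplacian G) y i  ∎
    where
    open ≡-Reasoning
    split : ∀ t e l y → (t * e - l) * y ≡ t * (e * y) - l * y
    split = solve-∀

  shiftedLaplacian-constantOnEdges : ∀ {w} → ConstantOnEdges w → ∀ t i → mulVec (shiftedLaplacian t) w i ≡ t * w i
  shiftedLaplacian-constantOnEdges {w} const t i =
    trans (shiftedLaplacian-apply t w i) (trans (cong (_-_ (t * w i)) (laplacian-constantOnEdges const i)) (ℤP.+-identityʳ _))

  -- The indicator w of a union of components and its complement 1 - w are both eigenvectors of t I - L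
  -- with eigenvalue t, and each pulls out one factor t.
  detℤ-shifted-disconnected : ∀ {w} s τ → ConstantOnEdges w → w s ≡ + 1 → w τ ≡ + 0 →
                              ∀ t → ∃ λ z → detℤ n (shiftedLaplacian t) ≡ t * (t * z)
  detℤ-shifted-disconnected {w} s τ const ws≡1 wτ≡0 t = detℤ n (setCol M₁ τ w′) , (begin
    detℤ n (shiftedLaplacian t)           ≡⟨ detℤ-eigencolumn n _ s w t ws≡1 (shiftedLaplacian-constantOnEdges const t) ⟩
    t * detℤ n M₁                         ≡⟨ cong (t *_) (detℤ-eigencolumn n M₁ τ w′ t w′τ≡1 M₁-eigen) ⟩
    t * (t * detℤ n (setCol M₁ τ w′))     ∎)
    where
    open ≡-Reasoning
    M₁ : Matrix n
    M₁ = setCol (shiftedLaplacian t) s w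
    w′ : Fin n → ℤ
    w′ c = + 1 - w c
    w′τ≡1 : w′ τ ≡ + 1
    w′τ≡1 = cong (_-_ (+ 1)) wτ≡0
    w′s≡0 : w′ s ≡ + 0
    w′s≡0 = cong (_-_ (+ 1)) ws≡1
    const′ : ConstantOnEdges w′
    const′ r c e = cong (_-_ (+ 1)) (const r c e)
    entry : ∀ r c → M₁ r c * w′ c ≡ shiftedLaplacian t r c * w′ c
    entry r c with c ≟ s
    ... | yes refl = trans (cong (w r *_) w′s≡0) (trans (ℤP.*-zeroʳ (w r))
                       (sym (trans (cong (shiftedLaplacian t r c *_) w′s≡0) (ℤP.*-zeroʳ (shiftedLaplacian t r c)))))
    ... | no _     = refl
    M₁-eigen : ∀ r → mulVec M₁ w′ r ≡ t * w′ r
    M₁-eigen r = trans (∑ℤ-cong n (entry r)) (shiftedLaplacian-constantOnEdges const′ t r)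

  ones : Fin n → ℤ
  ones _ = + 1

  groundedDet : ℤ → Fin n → ℤ
  groundedDet t v = detℤ n (setCol (shiftedLaplacian t) v ones)

  detℤ-shifted-grounded : ∀ t v → detℤ n (shiftedLaplacian t) ≡ t * groundedDet t v
  detℤ-shifted-grounded t v = detℤ-eigencolumn n _ v ones t refl (shiftedLaplacian-constantOnEdges (λ _ _ _ → refl) t)

  groundedDet-perturb : ∀ t v → ∃ λ z → groundedDet t v ≡ groundedDet (+ 0) v + t * z
  groundedDet-perturb t v = detℤ-perturb n _ _ (setCol (identityMatrix n) v (λ _ → + 0)) t entry
    where
    entry : ∀ r c → setCol (shiftedLaplacian t) v ones r c ≡
                    setCol (shiftedLaplacian (+ 0)) v ones r c + t * setCol (identityMatrix n) v (λ _ → + 0) r c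
    entry r c with c ≟ v
    ... | yes _ = sym (cong (_+_ (+ 1)) (ℤP.*-zeroʳ t))
    ... | no _  = split t (identityMatrix n r c) (laplacian G r c)
      where
      split : ∀ t e l → t * e - l ≡ (+ 0 * e - l) + t * e
      split = solve-∀

laplacian-columnSum : ∀ {n} (G : Graph n) c → ∑ℤ n (λ r → laplacian G r c) ≡ + 0
laplacian-columnSum {n} G c = trans (∑ℤ-cong n (λ r → trans (laplacian-sym G r c) (sym (ℤP.*-identityʳ _))))
                                     (laplacian-constantOnEdges G (λ _ _ _ → refl) c)

-- Maximum principle: along every edge leaving a vertex where a harmonic y is maximal, y stays maximal.
harmonic⇒constant : ∀ {n} (G : Graph n) → Connected G → (y : Fin n → ℤ) →
                    (∀ i → mulVec (laplacian G) y i ≡ + 0) → ∀ i j → y i ≡ y j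
harmonic⇒constant {suc m} G connected y harmonic i j = trans (fromMax i) (sym (fromMax j))
  where
  M : Fin (suc m)
  M = proj₁ (argmax m y)
  max : ∀ i → y i ≤ y M
  max = proj₂ (argmax m y)
  spread : ∀ a c → y a ≡ y M → adj G a c ≡ true → y c ≡ y M
  spread a c ya≡max a~c = trans (sym (ℤP.i-j≡0⇒i≡j (y a) (y c) ya-yc≡0)) ya≡max
    where
    term≥0 : ∀ c′ → + 0 ≤ adjℤ G a c′ * (y a - y c′)
    term≥0 c′ with adj G a c′
    ... | true  = subst (+ 0 ≤_) (sym (ℤP.*-identityˡ _)) (ℤP.i≤j⇒0≤j-i (subst (y c′ ≤_) (sym ya≡max) (max c′)))
    ... | false = ℤP.≤-refl
    ya-yc≡0 : y a - y c ≡ + 0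
    ya-yc≡0 = trans (sym (ℤP.*-identityˡ _)) (trans (cong (λ b → (if b then + 1 else + 0) * (y a - y c)) (sym a~c))
                (∑ℤ≡0⇒terms≡0 (suc m) term≥0 (trans (sym (laplacian-apply G y a)) (harmonic a)) c))
  along : ∀ {c} → Reach G M c → y c ≡ y M
  along here          = refl
  along (step r a~c) = spread _ _ (along r) a~c
  fromMax : ∀ c → y c ≡ y M
  fromMax c = along (connected M c)

size-cancel : ∀ {n} (v : Fin n) a → + n * a ≡ + 0 → a ≡ + 0
size-cancel {suc n} v a na≡0 with ℤP.i*j≡0⇒i≡0∨j≡0 (+ suc n) na≡0
... | inj₂ a≡0 = a≡0

-- A kernel vector x of the grounded matrix gives L x′ = x_v · 1 for x′ = x with x_v removed; summing the rows
-- forces x_v = 0, so x′ is harmonic, hence constant, hence zero.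
groundedKernel-trivial : ∀ {n} (G : Graph n) → Connected G → ∀ v {x} →
                         InKernel (setCol (shiftedLaplacian G (+ 0)) v (ones G)) x → ∀ c → x c ≡ + 0
groundedKernel-trivial {n} G connected v {x} x∈ker = x≡0
  where
  N : Matrix n
  N = setCol (shiftedLaplacian G (+ 0)) v (ones G)
  x′ : Fin n → ℤ
  x′ = without v x
  entry : ∀ r c → N r c * x c ≡ (if does (c ≟ v) then x v else + 0) - laplacian G r c * x′ c
  entry r c with c ≟ v
  ... | yes refl = trans (ℤP.*-identityˡ (x c)) (sym (drop (x c) (laplacian G r c)))
    where
    drop : ∀ a l → a - l * + 0 ≡ a
    drop = solve-∀
  ... | no _     = split (identityMatrix n r c) (laplacian G r c) (x c)
    where
    split : ∀ e l y → (+ 0 * e - l) * y ≡ + 0 - l * y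
    split = solve-∀
  row : ∀ r → mulVec (laplacian G) x′ r ≡ x v
  row r = sym (ℤP.i-j≡0⇒i≡j _ _ (trans (sym expand) (x∈ker r)))
    where
    expand : mulVec N x r ≡ x v - mulVec (laplacian G) x′ r
    expand = trans (∑ℤ-cong n (entry r)) (trans (∑ℤ-distrib-- n _ _)
                   (cong (_- mulVec (laplacian G) x′ r) (∑ℤ-indicator n v (x v))))
  n*xv≡0 : + n * x v ≡ + 0
  n*xv≡0 = begin
    + n * x v                                               ≡⟨ ∑ℤ-const n (x v) ⟨
    ∑ℤ n (λ _ → x v)                                        ≡⟨ ∑ℤ-cong n row ⟨
    ∑ℤ n (λ r → ∑ℤ n (λ c → laplacian G r c * x′ c))        ≡⟨ ∑ℤ-comm n n _ ⟩
    ∑ℤ n (λ c → ∑ℤ n (λ r → laplacian G r c * x′ c))        ≡⟨ ∑ℤ-cong n (λ c → *-distribʳ-∑ℤ n (x′ c) (λ r → laplacian G r c)) ⟩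
    ∑ℤ n (λ c → ∑ℤ n (λ r → laplacian G r c) * x′ c)        ≡⟨ ∑ℤ-zero n _ (λ c → trans (cong (_* x′ c) (laplacian-columnSum G c))
                                                                                          (ℤP.*-zeroˡ (x′ c))) ⟩
    + 0                                                     ∎
    where open ≡-Reasoning
  xv≡0 : x v ≡ + 0
  xv≡0 = size-cancel v (x v) n*xv≡0
  x′≡0 : ∀ c → x′ c ≡ + 0
  x′≡0 c = trans (harmonic⇒constant G connected x′ (λ r → trans (row r) xv≡0) c v)
                 (cong (if_then + 0 else x v) (dec-true (v ≟ v) refl))
  x≡0 : ∀ c → x c ≡ + 0
  x≡0 c with c ≟ v
  ... | yes refl = xv≡0
  ... | no c≢v   = trans (sym (without-≢ x c≢v)) (x′≡0 c)

connected⇒groundedDet≢0 : ∀ {n} (G : Graph n) → Connected G → ∀ v → groundedDet G (+ 0) v ≢ + 0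
connected⇒groundedDet≢0 {n} G connected v det≡0 with detℤ≡0⇒kernelVector n _ det≡0
... | x , x∈ker , (i , xi≢0) = xi≢0 (groundedKernel-trivial G connected v x∈ker i)

DivisibleBySquare : Poly → Set
DivisibleBySquare p = ∀ t → ∃ λ z → eval p t ≡ t * (t * z)

multiple-of-1+∣a∣⇒0 : ∀ a y → a ≡ + suc ℤ.∣ a ∣ * y → a ≡ + 0
multiple-of-1+∣a∣⇒0 a y a≡ =
  ℤP.∣i∣≡0⇒i≡0 (small ℤ.∣ y ∣ (trans (cong ℤ.∣_∣ a≡) (ℤP.abs-* (+ suc ℤ.∣ a ∣) y)))
  where
  small : ∀ q → ℤ.∣ a ∣ ≡ suc ℤ.∣ a ∣ ℕ.* q → ℤ.∣ a ∣ ≡ 0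
  small zero    e = trans e (ℕP.*-zeroʳ (suc ℤ.∣ a ∣))
  small (suc q) e = ⊥-elim (ℕP.<-irrefl refl (ℕP.≤-trans (ℕP.m≤m*n (suc ℤ.∣ a ∣) (suc q)) (ℕP.≤-reflexive (sym e))))

-- Evaluating at t = 0 kills the constant term; evaluating at t = 1 + |c₁| shows that c₁ is a multiple of a larger number.
divisibleBySquare⇒lowCoeffs : ∀ p → DivisibleBySquare p → coeff p 0 ≡ + 0 × coeff p 1 ≡ + 0
divisibleBySquare⇒lowCoeffs p divisible = c₀≡0 , c₁≡0
  where
  c₀ c₁ T : ℤ
  c₀ = coeff p 0
  c₁ = coeff p 1
  c₀≡0 : c₀ ≡ + 0
  c₀≡0 with eval-low-order p (+ 0) | divisible (+ 0)
  ... | r , low | z , div = trans (sym (at0 c₀ c₁ r)) (trans (sym low) (trans div (at0′ z)))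
    where
    at0 : ∀ c₀ c₁ r → c₀ + + 0 * c₁ + + 0 * + 0 * r ≡ c₀
    at0 = solve-∀
    at0′ : ∀ z → + 0 * (+ 0 * z) ≡ + 0
    at0′ = solve-∀
  T = + suc ℤ.∣ c₁ ∣
  c₁≡0 : c₁ ≡ + 0
  c₁≡0 with eval-low-order p T | divisible T
  ... | r , low | z , div = multiple-of-1+∣a∣⇒0 c₁ (z - r) (ℤP.*-cancelˡ-≡ T c₁ (T * (z - r)) (begin
    T * c₁                              ≡⟨ isolate c₀ T c₁ r c₀≡0 ⟨
    c₀ + T * c₁ + T * T * r - T * T * r ≡⟨ cong (_- T * T * r) low ⟨
    eval p T - T * T * r                ≡⟨ cong (_- T * T * r) div ⟩
    T * (T * z) - T * T * r             ≡⟨ factor T z r ⟩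
    T * (T * (z - r))                   ∎))
    where
    open ≡-Reasoning
    isolate : ∀ c₀ T c₁ r → c₀ ≡ + 0 → c₀ + T * c₁ + T * T * r - T * T * r ≡ T * c₁
    isolate _ T c₁ r refl = cancel T c₁ r
      where
      cancel : ∀ T c₁ r → + 0 + T * c₁ + T * T * r - T * T * r ≡ T * c₁
      cancel = solve-∀
    factor : ∀ T z r → T * (T * z) - T * T * r ≡ T * (T * (z - r))
    factor = solve-∀

lowCoeffs⇒divisibleBySquare : ∀ p → coeff p 0 ≡ + 0 → coeff p 1 ≡ + 0 → DivisibleBySquare p
lowCoeffs⇒divisibleBySquare p c₀≡0 c₁≡0 t with eval-low-order p t
... | r , low = r , trans low (trans (cong₂ (λ a b → a + t * b + t * t * r) c₀≡0 c₁≡0) (factor t r))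
  where
  factor : ∀ t r → + 0 + t * + 0 + t * t * r ≡ t * (t * r)
  factor = solve-∀

divisibleBySquare-coeffs : ∀ p q → (∀ i → coeff p i ≡ coeff q i) → DivisibleBySquare p → DivisibleBySquare q
divisibleBySquare-coeffs p q p≡q divisible = lowCoeffs⇒divisibleBySquare q
  (trans (sym (p≡q 0)) (proj₁ low)) (trans (sym (p≡q 1)) (proj₂ low))
  where
  low : coeff p 0 ≡ + 0 × coeff p 1 ≡ + 0
  low = divisibleBySquare⇒lowCoeffs p divisible

-- The constant term of D(t) = groundedDet t v is nonzero, so t · D(t) is not divisible by t² at t = 1 + |D(0)|.
connected⇒¬divisibleBySquare : ∀ {n} (G : Graph (suc n)) → Connected G → ¬ DivisibleBySquare (laplacianCharPoly G)
connected⇒¬divisibleBySquare {n} G connected divisible =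
  connected⇒groundedDet≢0 G connected zero (multiple-of-1+∣a∣⇒0 D₀ (y - z) D₀≡T[y-z])
  where
  open ≡-Reasoning
  D₀ T y z : ℤ
  D₀ = groundedDet G (+ 0) zero
  T = + suc ℤ.∣ D₀ ∣
  z = proj₁ (groundedDet-perturb G T zero)
  y = proj₁ (divisible T)
  D₀+Tz≡Ty : D₀ + T * z ≡ T * y
  D₀+Tz≡Ty = ℤP.*-cancelˡ-≡ T _ _ (begin
    T * (D₀ + T * z)                     ≡⟨ cong (T *_) (proj₂ (groundedDet-perturb G T zero)) ⟨
    T * groundedDet G T zero             ≡⟨ detℤ-shifted-grounded G T zero ⟨
    detℤ (suc n) (shiftedLaplacian G T)  ≡⟨ eval-laplacianCharPoly G T ⟨
    eval (laplacianCharPoly G) T         ≡⟨ proj₂ (divisible T) ⟩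
    T * (T * y)                          ∎)
  D₀≡T[y-z] : D₀ ≡ T * (y - z)
  D₀≡T[y-z] = begin
    D₀                   ≡⟨ isolate D₀ T z ⟨
    D₀ + T * z - T * z   ≡⟨ cong (_- T * z) D₀+Tz≡Ty ⟩
    T * y - T * z        ≡⟨ factor T y z ⟩
    T * (y - z)          ∎
    where
    isolate : ∀ d t z → d + t * z - t * z ≡ d
    isolate = solve-∀
    factor : ∀ t y z → t * y - t * z ≡ t * (y - z)
    factor = solve-∀

reach-trans : ∀ {n} {G : Graph n} {i j l} → Reach G i j → Reach G j l → Reach G i l
reach-trans i⇝j here         = i⇝j
reach-trans i⇝j (step j⇝ e) = step (reach-trans i⇝j j⇝) e

reach-sym : ∀ {n} {G : Graph n} {i j} → Reach G i j → Reach G j i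
reach-sym                 here                      = here
reach-sym {G = G} (step {j} {l} i⇝j e) = reach-trans (step here (trans (Graph.sym G l j) e)) (reach-sym i⇝j)

¬¬-decide-all : ∀ n (P : Fin n → Set) → ¬ ¬ (∀ c → Dec (P c))
¬¬-decide-all zero    P give = give (λ ())
¬¬-decide-all (suc n) P give = ¬¬-excluded-middle (λ P0? →
  ¬¬-decide-all n (P ∘ suc) (λ P? → give (λ { zero → P0? ; (suc c) → P? c })))

-- The component of vertex 0 is only decidable up to double negation, which suffices since the goal is negative.
disconnected⇒divisibleBySquare : ∀ {n} (G : Graph n) → ¬ Connected G → ¬ ¬ DivisibleBySquare (laplacianCharPoly G)
disconnected⇒divisibleBySquare {zero}  G disconnected _ = disconnected (λ ())
disconnected⇒divisibleBySquare {suc m} G disconnected ¬divisible = ¬¬-decide-all (suc m) (Reach G zero) split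
  where
  split : (∀ c → Dec (Reach G zero c)) → ⊥
  split reach? with all? reach?
  ... | yes all-reached = disconnected (λ i j → reach-trans (reach-sym (all-reached i)) (all-reached j))
  ... | no ¬all-reached with ¬∀⟶∃¬ (suc m) _ reach? ¬all-reached
  ... | τ , unreached = ¬divisible (λ t →
          let z , det≡ = detℤ-shifted-disconnected G zero τ const w0≡1 wτ≡0 t in z , trans (eval-laplacianCharPoly G t) det≡)
    where
    w : Fin (suc m) → ℤ
    w c = if does (reach? c) then + 1 else + 0
    const : ConstantOnEdges G w
    const r c e with reach? r | reach? c
    ... | yes _    | yes _    = refl
    ... | no _     | no _     = refl
    ... | yes 0⇝r | no ¬0⇝c = ⊥-elim (¬0⇝c (step 0⇝r e))
    ... | no ¬0⇝r | yes 0⇝c = ⊥-elim (¬0⇝r (step 0⇝c (trans (Graph.sym G c r) e)))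
    w0≡1 : w zero ≡ + 1
    w0≡1 with reach? zero
    ... | yes _   = refl
    ... | no ¬0⇝0 = ⊥-elim (¬0⇝0 here)
    wτ≡0 : w τ ≡ + 0
    wτ≡0 with reach? τ
    ... | yes 0⇝τ = ⊥-elim (unreached 0⇝τ)
    ... | no _     = refl

sameLaplacianSpectrum-connected : ∀ {n} (Γ R : Graph (suc n)) → SameLaplacianSpectrum Γ R → Connected R → ¬ ¬ Connected Γ
sameLaplacianSpectrum-connected Γ R same connectedR disconnectedΓ = disconnected⇒divisibleBySquare Γ disconnectedΓ
  (connected⇒¬divisibleBySquare R connectedR ∘ divisibleBySquare-coeffs (laplacianCharPoly Γ) (laplacianCharPoly R) same)

-- Degree sums from the spectrum

sameLaplacianSpectrum-degreeSums : ∀ m (Γ R : Graph (suc (suc m))) → SameLaplacianSpectrum Γ R →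
  let N = suc (suc m) in
  ∑ℤ N (degreeℤ Γ) ≡ ∑ℤ N (degreeℤ R) ×
  ∑ℤ N (λ i → degreeℤ Γ i * degreeℤ Γ i) ≡ ∑ℤ N (λ i → degreeℤ R i * degreeℤ R i)
sameLaplacianSpectrum-degreeSums m Γ R same = D≡ , Q≡
  where
  D : ∀ {n} → Graph n → ℤ
  D {n} G = ∑ℤ n (degreeℤ G)
  Q : ∀ {n} → Graph n → ℤ
  Q {n} G = ∑ℤ n (λ i → degreeℤ G i * degreeℤ G i)
  D≡ : D Γ ≡ D R
  D≡ = ℤP.neg-injective (begin
    - D Γ                                  ≡⟨ laplacianCharPoly-coeff-degreeSum m Γ ⟨
    coeff (laplacianCharPoly Γ) (suc m)    ≡⟨ same (suc m) ⟩
    coeff (laplacianCharPoly R) (suc m)    ≡⟨ laplacianCharPoly-coeff-degreeSum m R ⟩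
    - D R                                  ∎)
    where open ≡-Reasoning
  Q≡ : Q Γ ≡ Q R
  Q≡ = begin
    Q Γ                                          ≡⟨ solveFor (D Γ) (Q Γ) ⟨
    D Γ * D Γ - D Γ - (D Γ * D Γ - (Q Γ + D Γ))  ≡⟨ cong (_-_ (D Γ * D Γ - D Γ)) (laplacianCharPoly-coeff-degreeSquares m Γ) ⟨
    D Γ * D Γ - D Γ - + 2 * coeff (laplacianCharPoly Γ) m
      ≡⟨ cong₂ (λ d c → d * d - d - + 2 * c) D≡ (same m) ⟩
    D R * D R - D R - + 2 * coeff (laplacianCharPoly R) m
      ≡⟨ cong (_-_ (D R * D R - D R)) (laplacianCharPoly-coeff-degreeSquares m R) ⟩
    D R * D R - D R - (D R * D R - (Q R + D R))  ≡⟨ solveFor (D R) (Q R) ⟩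
    Q R                                          ∎
    where
    open ≡-Reasoning
    solveFor : ∀ d q → d * d - d - (d * d - (q + d)) ≡ q
    solveFor = solve-∀

excess : ∀ {n} → Graph n → Fin n → ℤ
excess G i = degreeℤ G i - + 2

∑excess² : ∀ {n} (G : Graph n) → ∑ℤ n (λ i → excess G i * excess G i) ≡
           ∑ℤ n (λ i → degreeℤ G i * degreeℤ G i) + (- + 4 * ∑ℤ n (degreeℤ G) + + n * + 4)
∑excess² {n} G = begin
  ∑ℤ n (λ i → excess G i * excess G i)                                      ≡⟨ ∑ℤ-cong n (λ i → expand (degreeℤ G i)) ⟩
  ∑ℤ n (λ i → degreeℤ G i * degreeℤ G i + (- + 4 * degreeℤ G i + + 4))      ≡⟨ ∑ℤ-distrib-+ n _ _ ⟩
  Q + ∑ℤ n (λ i → - + 4 * degreeℤ G i + + 4)                                ≡⟨ cong (_+_ Q) (∑ℤ-distrib-+ n _ _) ⟩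
  Q + (∑ℤ n (λ i → - + 4 * degreeℤ G i) + ∑ℤ n (λ _ → + 4))
    ≡⟨ cong (_+_ Q) (cong₂ _+_ (*-distribˡ-∑ℤ n (- + 4) (degreeℤ G)) (∑ℤ-const n (+ 4))) ⟩
  Q + (- + 4 * ∑ℤ n (degreeℤ G) + + n * + 4)                                ∎
  where
  open ≡-Reasoning
  Q : ℤ
  Q = ∑ℤ n (λ i → degreeℤ G i * degreeℤ G i)
  expand : ∀ d → (d - + 2) * (d - + 2) ≡ d * d + (- + 4 * d + + 4)
  expand = solve-∀

rose-∑excess² : ∀ {n} (R : Graph n) k v → degree R v ≡ 2 ℕ.* k → (∀ u → u ≢ v → degree R u ≡ 2) →
                ∑ℤ n (λ i → excess R i * excess R i) ≡ hubExcess k * hubExcess k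
rose-∑excess² {n} R k v hub petals =
  trans (∑ℤ-single n _ v (λ u u≢v → cong square (petals u u≢v))) (cong square hub)
  where
  square : ℕ → ℤ
  square d = (+ d - + 2) * (+ d - + 2)

sameLaplacianSpectrum-∑excess² : ∀ m (Γ R : Graph (suc (suc m))) → SameLaplacianSpectrum Γ R →
  ∑ℤ (suc (suc m)) (λ i → excess Γ i * excess Γ i) ≡ ∑ℤ (suc (suc m)) (λ i → excess R i * excess R i)
sameLaplacianSpectrum-∑excess² m Γ R same = trans (∑excess² Γ) (trans
  (cong₂ (λ q d → q + (- + 4 * d + + suc (suc m) * + 4)) (proj₂ (sameLaplacianSpectrum-degreeSums m Γ R same))
                                                           (proj₁ (sameLaplacianSpectrum-degreeSums m Γ R same)))
  (sym (∑excess² R)))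

excess-injective : ∀ {d e} → + d - + 2 ≡ + e - + 2 → d ≡ e
excess-injective d-2≡e-2 = ℤP.+-injective (∙-cancelʳ (- + 2) _ _ d-2≡e-2)

single-vertex-degree : ∀ (G : Graph 1) → degree G zero ≡ 0
single-vertex-degree G rewrite irrefl G zero = refl

lemma5p2 : (k : ℕ) → 3 ℕ.≤ k → (n : ℕ) → (Γ R : Graph n) →
    IsKRose k R → SameLaplacianSpectrum Γ R → ¬ IsRose Γ →
    cubeExcess Γ < (+ (2 ℕ.* k) - + 2) * (+ (2 ℕ.* k) - + 2) * (+ (2 ℕ.* k) - + 2) - + 6 * + k
lemma5p2 k       _         zero          Γ R (_ , _ , () , _)         _    _
lemma5p2 (suc k) _         (suc zero)    Γ R (_ , _ , zero , hub , _) _    _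
  with () ← trans (sym (single-vertex-degree R)) hub
lemma5p2 k       3≤k       (suc (suc m)) Γ R (2≤k , connectedR , v , hub , petals) same ¬rose =
  [ id , spike⇒⊥ ]′
  (excess-inequality (suc m) (excess Γ) k 3≤k
    (trans (sameLaplacianSpectrum-∑excess² m Γ R same) (rose-∑excess² R k v hub petals)))
  where
  spike⇒⊥ : Σ (Fin (suc (suc m))) (λ w → excess Γ w ≡ hubExcess k × (∀ u → u ≢ w → excess Γ u ≡ + 0)) →
            cubeExcess Γ < cubeBound k
  spike⇒⊥ (w , hubΓ , petalsΓ) = ⊥-elim (sameLaplacianSpectrum-connected Γ R same connectedR (λ connectedΓ →
    ¬rose (k , 2≤k , connectedΓ , w , excess-injective hubΓ , λ u u≢w → excess-injective (petalsΓ u u≢w))))
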